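{- Let $n\geq 2$, $l\geq 2$ and $G=K_{2n}\circ_{n}K_{2n}\circ_{n}\cdots\circ_{n}K_{2n}$ ($l$ copies of $K_{2n}$). Then the spectrum of $\epsilon(G)$ consists of $-1$ with multiplicity at least $n-1$, $0$ with multiplicity at least $(n-1)l$, and the roots of the polynomial $(x+2n)^{l-1}\big(x^{2}+x(1-n(2l-1))+n^{2}(l-2)-2n(l-1)\big)$.
   Context: All graphs are finite, simple and connected. $d(u,v)$ is the distance and $e(v)=\max_u d(u,v)$ the eccentricity. The eccentricity matrix $\epsilon(G)$ has $(u,v)$ entry $d(u,v)$ if $d(u,v)=\min\{e(u),e(v)\}$ and $0$ otherwise. The graph $K_{2n}\circ_{n}\cdots\circ_{n}K_{2n}$ ($l$ copies) has vertex set $C\cup P_1\cup\cdots\cup P_l$ (disjoint), $|C|=|P_i|=n$, each $C\cup P_i$ induces a complete graph, and no edges between $P_i$ and $P_j$ for $i\ne j$. -}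

module Defs where

open import Data.Nat as ℕ using (ℕ; zero; suc; _⊔_; _⊓_)
open import Data.Nat.DivMod using (_/_)
open import Data.Bool using (Bool; true; false; _∧_; _∨_; not; if_then_else_)
open import Data.Fin using (Fin; zero; suc; toℕ; punchIn)
open import Data.Integer as ℤ using (ℤ; +_; -_; _+_; _*_; _-_)
open import Relation.Nullary.Decidable using (⌊_⌋)

anyFin : ∀ {N} → (Fin N → Bool) → Bool
anyFin {zero}  f = false
anyFin {suc N} f = f zero ∨ anyFin (λ i → f (suc i))

maxFin : ∀ {N} → (Fin N → ℕ) → ℕ
maxFin {zero}  f = 0
maxFin {suc N} f = f zero ⊔ maxFin (λ i → f (suc i))

sumFin : ∀ {N} → (Fin N → ℤ) → ℤ
sumFin {zero}  f = + 0
sumFin {suc N} f = f zero + sumFin (λ i → f (suc i))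

reach : ∀ {N} → (Fin N → Fin N → Bool) → ℕ → Fin N → Fin N → Bool
reach adj zero    u v = ⌊ toℕ u ℕ.≟ toℕ v ⌋
reach adj (suc k) u v = reach adj k u v ∨ anyFin (λ w → reach adj k u w ∧ adj w v)

search : (ℕ → Bool) → ℕ → ℕ → ℕ
search p k zero       = k
search p k (suc fuel) = if p k then k else search p (suc k) fuel

-- distance d(u,v): the least k such that v is reachable from u by a walk of
-- length ≤ k (for a connected graph on N vertices this is < N).
dist : ∀ {N} → (Fin N → Fin N → Bool) → Fin N → Fin N → ℕ
dist {N} adj u v = search (λ k → reach adj k u v) 0 N

ecc : ∀ {N} → (Fin N → Fin N → Bool) → Fin N → ℕ
ecc adj u = maxFin (λ v → dist adj u v)

eccMatrix : ∀ {N} → (Fin N → Fin N → Bool) → Fin N → Fin N → ℤ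
eccMatrix adj u v =
  if ⌊ dist adj u v ℕ.≟ (ecc adj u ⊓ ecc adj v) ⌋ then + dist adj u v else + 0

det : ∀ {m} → (Fin m → Fin m → ℤ) → ℤ
det {zero}  A = + 1
det {suc m} A = sumFin (λ j → sign j * (A zero j * det (λ r c → A (suc r) (punchIn j c))))
  where
  sign : ∀ {k} → Fin k → ℤ
  sign j = if ⌊ (toℕ j ℕ.% 2) ℕ.≟ 0 ⌋ then + 1 else - (+ 1)

charPoly : ∀ {m} → (Fin m → Fin m → ℤ) → ℤ → ℤ
charPoly A x = det (λ i j → (if ⌊ toℕ i ℕ.≟ toℕ j ⌋ then x else + 0) - A i j)

-- Vertex i lies in block ⌊i / n⌋ : block 0 is C, block t (1 ≤ t ≤ l) is P_t.

block : ℕ → ℕ → ℕ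
block zero    i = 0
block (suc k) i = i / suc k

gluedK : (n l : ℕ) → Fin (n ℕ.+ l ℕ.* n) → Fin (n ℕ.+ l ℕ.* n) → Bool
gluedK n l u v =
  not ⌊ toℕ u ℕ.≟ toℕ v ⌋ ∧
  (⌊ bu ℕ.≟ 0 ⌋ ∨ ⌊ bv ℕ.≟ 0 ⌋ ∨ ⌊ bu ℕ.≟ bv ⌋)
  where
  bu = block n (toℕ u)
  bv = block n (toℕ v)

_^ℤ_ : ℤ → ℕ → ℤ
x ^ℤ zero  = + 1
x ^ℤ suc k = x * (x ^ℤ k)

targetPoly : (n l : ℕ) → ℤ → ℤ
targetPoly n l x =
  (x ^ℤ ((n ℕ.∸ 1) ℕ.* l)) * ((x + + 1) ^ℤ (n ℕ.∸ 1)) *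
  ((x + + (2 ℕ.* n)) ^ℤ (l ℕ.∸ 1)) *
  (x * x + x * (+ 1 - + n * (+ 2 * + l - + 1))
     + (+ n * + n) * (+ l - + 2) - + 2 * + n * (+ l - + 1))

-- xI − ε(G) is a "class matrix": each vertex v carries a label ℓ v (its block C, P₁, …, P_l) and
-- a weight w v, and its (v, u) entry is δ_vu Λ(ℓ v) + w v · Q(ℓ v, ℓ u), because off the diagonal
-- ε(G) only depends on the blocks of the two vertices.  Two consecutive vertices with a common
-- label a can be merged: subtracting one of their columns from the other and then adding the
-- corresponding rows leaves Λ a alone in its column, so the determinant is Λ a times the
-- determinant for the profile in which both became one vertex of summed weight.  Merging C gives
-- (x+1)^(n-1) and merging each P_s gives x^(n-1).  In the resulting quotient all P_s may share one
-- label with Λ = x + 2n; merging them gives (x+2n)^(l-1), and the remaining 2×2 quotient matrix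
-- has the quadratic factor as its determinant.

module Submission where

open import Defs
open import Data.Nat using (ℕ; _≤_)
open import Data.Integer using (ℤ)
open import Relation.Binary.PropositionalEquality using (_≡_)

open import Data.Bool using (Bool; true; false; if_then_else_; _∧_; _∨_; not)
open import Data.Bool.Properties using (∨-zeroʳ; ∧-zeroʳ)
open import Data.Empty using (⊥-elim)
open import Data.Fin as Fin using (Fin; zero; suc; toℕ; fromℕ<; punchIn; punchOut)
open import Data.Fin.Properties
  using (punchInᵢ≢i; punchIn-punchOut; punchIn-injective; suc-injective; toℕ-injective; toℕ-fromℕ<; toℕ<n)
open import Data.Integer as ℤ using (+_; -_; _+_; _*_; _-_)
import Data.Integer.Properties as ℤ
open import Data.Integer.Tactic.RingSolver using (solve-∀)
open import Data.List using (List; []; _∷_; _++_; length; replicate)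
open import Data.List.Properties
  using (length-++; length-++-sucʳ; length-++-≤ˡ; length-replicate; ++-assoc; ++-identityʳ)
open import Data.Nat as ℕ using (zero; suc; _<_; _⊓_; z≤n; s≤s)
import Data.Nat.Properties as ℕ
open import Data.Nat.DivMod using (_%_; _/_; [m+n]%n≡m%n; n/n≡1; m*n/n≡m; m<n⇒m/n≡0; m/n≡1+[m∸n]/n)
open import Data.Product using (Σ; _×_; _,_; proj₁; proj₂)
open import Data.Sum using (_⊎_; inj₁; inj₂; [_,_]′)
open import Function using (_∘_)
open import Relation.Binary.PropositionalEquality
  using (_≢_; _≗_; refl; sym; trans; cong; cong₂; subst; module ≡-Reasoning)
open import Relation.Nullary using (¬_; Dec; yes; no)
open import Relation.Nullary.Decidable using (⌊_⌋; isYes≗does; dec-true; dec-false)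
open import Algebra.Properties.Semiring.Sum ℤ.+-*-semiring
  using (sum; sum-cong-≗; ∑-distrib-+; ∑-comm; sum-remove; *-distribˡ-sum)

⌊⌋-true : ∀ {A : Set} (a? : Dec A) → A → ⌊ a? ⌋ ≡ true
⌊⌋-true a? a = trans (isYes≗does a?) (dec-true a? a)

⌊⌋-false : ∀ {A : Set} (a? : Dec A) → ¬ A → ⌊ a? ⌋ ≡ false
⌊⌋-false a? ¬a = trans (isYes≗does a?) (dec-false a? ¬a)

sumFin≡sum : ∀ {N} (f : Fin N → ℤ) → sumFin f ≡ sum f
sumFin≡sum {zero}  f = refl
sumFin≡sum {suc N} f = cong (_+_ (f zero)) (sumFin≡sum (f ∘ suc))

sumFin-cong : ∀ {N} {f g : Fin N → ℤ} → f ≗ g → sumFin f ≡ sumFin g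
sumFin-cong {f = f} {g} f≗g =
  trans (sumFin≡sum f) (trans (sum-cong-≗ {x = f} {y = g} f≗g) (sym (sumFin≡sum g)))

sumFin-distrib-+ : ∀ {N} (f g : Fin N → ℤ) →
  sumFin (λ i → f i + g i) ≡ sumFin f + sumFin g
sumFin-distrib-+ f g = trans (sumFin≡sum (λ i → f i + g i))
  (trans (∑-distrib-+ f g) (sym (cong₂ _+_ (sumFin≡sum f) (sumFin≡sum g))))

*-distribˡ-sumFin : ∀ {N} (a : ℤ) (f : Fin N → ℤ) →
  a * sumFin f ≡ sumFin (λ i → a * f i)
*-distribˡ-sumFin a f = trans (cong (_*_ a) (sumFin≡sum f))
  (trans (*-distribˡ-sum a f) (sym (sumFin≡sum (λ i → a * f i))))

sumFin-comm : ∀ {M N} (f : Fin M → Fin N → ℤ) →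
  sumFin (λ i → sumFin (f i)) ≡ sumFin (λ j → sumFin (λ i → f i j))
sumFin-comm f = begin
  sumFin (λ i → sumFin (f i))            ≡⟨ sumFin-cong (λ i → sumFin≡sum (f i)) ⟩
  sumFin (λ i → sum (f i))               ≡⟨ sumFin≡sum (λ i → sum (f i)) ⟩
  sum (λ i → sum (f i))                  ≡⟨ ∑-comm f ⟩
  sum (λ j → sum (λ i → f i j))          ≡⟨ sumFin≡sum (λ j → sum (λ i → f i j)) ⟨
  sumFin (λ j → sum (λ i → f i j))       ≡⟨ sumFin-cong (λ j → sumFin≡sum (λ i → f i j)) ⟨
  sumFin (λ j → sumFin (λ i → f i j))    ∎
  where open ≡-Reasoning

sumFin-remove : ∀ {N} (c : Fin (suc N)) (f : Fin (suc N) → ℤ) →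
  sumFin f ≡ f c + sumFin (f ∘ punchIn c)
sumFin-remove c f = trans (sumFin≡sum f)
  (trans (sum-remove {i = c} f) (cong (_+_ (f c)) (sym (sumFin≡sum (f ∘ punchIn c)))))

sumFin-zero : ∀ {N} (f : Fin N → ℤ) → (∀ i → f i ≡ + 0) → sumFin f ≡ + 0
sumFin-zero {zero}  f f≡0 = refl
sumFin-zero {suc N} f f≡0 = cong₂ _+_ (f≡0 zero) (sumFin-zero (f ∘ suc) (f≡0 ∘ suc))

sumFin-single : ∀ {N} (c : Fin N) (f : Fin N → ℤ) → (∀ j → j ≢ c → f j ≡ + 0) → sumFin f ≡ f c
sumFin-single {suc N} c f f≡0 = begin
  sumFin f                          ≡⟨ sumFin-remove c f ⟩
  f c + sumFin (f ∘ punchIn c)      ≡⟨ cong (_+_ (f c)) (sumFin-zero _ (λ k → f≡0 _ (punchInᵢ≢i c k))) ⟩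
  f c + + 0                         ≡⟨ ℤ.+-identityʳ (f c) ⟩
  f c                               ∎
  where open ≡-Reasoning

-- Determinants

Matrix : ℕ → Set
Matrix m = Fin m → Fin m → ℤ

-- The sign used by det in Defs, so that det unfolds to Laplace expansions with it.
sign : ℕ → ℤ
sign k = if ⌊ k % 2 ℕ.≟ 0 ⌋ then + 1 else - (+ 1)

sign-suc-suc : ∀ k → sign (suc (suc k)) ≡ sign k
sign-suc-suc k = cong (λ r → if ⌊ r ℕ.≟ 0 ⌋ then + 1 else - (+ 1))
  (trans (cong (_% 2) (ℕ.+-comm 2 k)) ([m+n]%n≡m%n k 2))

sign-suc : ∀ k → sign (suc k) ≡ - sign k
sign-suc zero          = refl
sign-suc (suc zero)    = refl
sign-suc (suc (suc k)) = begin
  sign (suc (suc (suc k)))  ≡⟨ sign-suc-suc (suc k) ⟩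
  sign (suc k)              ≡⟨ sign-suc k ⟩
  - sign k                  ≡⟨ cong -_ (sign-suc-suc k) ⟨
  - sign (suc (suc k))      ∎
  where open ≡-Reasoning

sign-double : ∀ k → sign (k ℕ.+ k) ≡ + 1
sign-double zero    = refl
sign-double (suc k) = begin
  sign (suc (k ℕ.+ suc k))  ≡⟨ cong (sign ∘ suc) (ℕ.+-suc k k) ⟩
  sign (suc (suc (k ℕ.+ k))) ≡⟨ sign-suc-suc (k ℕ.+ k) ⟩
  sign (k ℕ.+ k)            ≡⟨ sign-double k ⟩
  + 1                       ∎
  where open ≡-Reasoning

minor : ∀ {m} → Matrix (suc m) → Fin (suc m) → Fin (suc m) → Matrix m
minor A r c i j = A (punchIn r i) (punchIn c j)

transpose : ∀ {m} → Matrix m → Matrix m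
transpose A i j = A j i

det-cong : ∀ {m} {A B : Matrix m} → (∀ i j → A i j ≡ B i j) → det A ≡ det B
det-cong {zero}  A≡B = refl
det-cong {suc m} A≡B = sumFin-cong λ j →
  cong₂ (λ a d → sign (toℕ j) * (a * d)) (A≡B zero j) (det-cong (λ r c → A≡B (suc r) (punchIn j c)))

det-expand-firstColumn : ∀ {m} (A : Matrix (suc m)) →
  det A ≡ sumFin (λ i → sign (toℕ i) * (A i zero * det (minor A i zero)))
det-expand-firstColumn {zero}  A = refl
det-expand-firstColumn {suc m} A = cong (_+_ (sign 0 * (A zero zero * det (minor A zero zero)))) (begin
  sumFin (λ j → sign (suc (toℕ j)) * (a j * det (minor A zero (suc j))))
    ≡⟨ sumFin-cong (λ j → cong (λ d → sign (suc (toℕ j)) * (a j * d))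
                                 (det-expand-firstColumn (minor A zero (suc j)))) ⟩
  sumFin (λ j → sign (suc (toℕ j)) * (a j * sumFin (λ i → sign (toℕ i) * (b i * D i j))))
    ≡⟨ sumFin-cong (λ j → pull-in (sign (suc (toℕ j))) (a j) (λ i → sign (toℕ i) * (b i * D i j))) ⟩
  sumFin (λ j → sumFin (λ i → sign (suc (toℕ j)) * (a j * (sign (toℕ i) * (b i * D i j)))))
    ≡⟨ sumFin-comm (λ i j → sign (suc (toℕ j)) * (a j * (sign (toℕ i) * (b i * D i j)))) ⟨
  sumFin (λ i → sumFin (λ j → sign (suc (toℕ j)) * (a j * (sign (toℕ i) * (b i * D i j)))))
    ≡⟨ sumFin-cong (λ i → sumFin-cong (λ j → swap-signs (toℕ i) (toℕ j) (a j) (b i) (D i j))) ⟩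
  sumFin (λ i → sumFin (λ j → sign (suc (toℕ i)) * (b i * (sign (toℕ j) * (a j * D i j)))))
    ≡⟨ sumFin-cong (λ i → pull-in (sign (suc (toℕ i))) (b i) (λ j → sign (toℕ j) * (a j * D i j))) ⟨
  sumFin (λ i → sign (suc (toℕ i)) * (b i * det (minor A (suc i) zero)))
    ∎)
  where
  open ≡-Reasoning
  a b : Fin (suc m) → ℤ
  a j = A zero (suc j)
  b i = A (suc i) zero
  D : Fin (suc m) → Fin (suc m) → ℤ
  D i j = det (λ r c → A (suc (punchIn i r)) (suc (punchIn j c)))
  pull-in : ∀ {N} s x (f : Fin N → ℤ) → s * (x * sumFin f) ≡ sumFin (λ k → s * (x * f k))
  pull-in s x f = trans (cong (_*_ s) (*-distribˡ-sumFin x f)) (*-distribˡ-sumFin s (λ k → x * f k))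
  swap-signs : ∀ i j x y d →
    sign (suc j) * (x * (sign i * (y * d))) ≡ sign (suc i) * (y * (sign j * (x * d)))
  swap-signs i j x y d rewrite sign-suc i | sign-suc j = ring (sign i) (sign j) x y d
    where
    ring : ∀ si sj x y d → - sj * (x * (si * (y * d))) ≡ - si * (y * (sj * (x * d)))
    ring = solve-∀

det-transpose : ∀ {m} (A : Matrix m) → det (transpose A) ≡ det A
det-transpose {zero}  A = refl
det-transpose {suc m} A = trans
  (sumFin-cong (λ j → cong (λ d → sign (toℕ j) * (A j zero * d)) (det-transpose (minor A j zero))))
  (sym (det-expand-firstColumn A))

AgreeOffColumn : ∀ {m} → Fin m → Matrix m → Matrix m → Set
AgreeOffColumn c A B = ∀ r k → k ≢ c → A r k ≡ B r k

agreeOffColumn-minor : ∀ {m} {c : Fin (suc m)} {A B : Matrix (suc m)} (j : Fin (suc m)) →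
  (j≢c : j ≢ c) → AgreeOffColumn c A B → AgreeOffColumn (punchOut j≢c) (minor A zero j) (minor B zero j)
agreeOffColumn-minor j j≢c A≈B r k k≢c′ = A≈B (suc r) (punchIn j k) λ jk≡c →
  k≢c′ (punchIn-injective j k _ (trans jk≡c (sym (punchIn-punchOut j≢c))))

det-linear-column : ∀ {m} (c : Fin m) (z : ℤ) (A B C : Matrix m) →
  AgreeOffColumn c C A → AgreeOffColumn c B A → (∀ r → C r c ≡ A r c + z * B r c) →
  det C ≡ det A + z * det B
det-linear-column {suc m} c z A B C C≈A B≈A Cc = begin
  det C                                  ≡⟨ sumFin-cong term ⟩
  sumFin (λ j → tA j + z * tB j)         ≡⟨ sumFin-distrib-+ tA (λ j → z * tB j) ⟩
  det A + sumFin (λ j → z * tB j)        ≡⟨ cong (_+_ (det A)) (*-distribˡ-sumFin z tB) ⟨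
  det A + z * det B                      ∎
  where
  open ≡-Reasoning
  tA tB : Fin (suc m) → ℤ
  tA j = sign (toℕ j) * (A zero j * det (minor A zero j))
  tB j = sign (toℕ j) * (B zero j * det (minor B zero j))
  minor-off-c : ∀ {X Y : Matrix (suc m)} → AgreeOffColumn c X Y → det (minor X zero c) ≡ det (minor Y zero c)
  minor-off-c X≈Y = det-cong λ r k → X≈Y (suc r) (punchIn c k) (punchInᵢ≢i c k)
  term : ∀ j → sign (toℕ j) * (C zero j * det (minor C zero j)) ≡ tA j + z * tB j
  term j with j Fin.≟ c
  ... | yes refl = begin
    s * (C zero j * det (minor C zero j))
      ≡⟨ cong₂ (λ x d → s * (x * d)) (Cc zero) (minor-off-c C≈A) ⟩
    s * ((A zero j + z * B zero j) * det (minor A zero j))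
      ≡⟨ ring s (A zero j) (B zero j) z _ ⟩
    tA j + z * (s * (B zero j * det (minor A zero j)))
      ≡⟨ cong (λ d → tA j + z * (s * (B zero j * d))) (minor-off-c B≈A) ⟨
    tA j + z * tB j ∎
    where
    s = sign (toℕ j)
    ring : ∀ s a b z d → s * ((a + z * b) * d) ≡ s * (a * d) + z * (s * (b * d))
    ring = solve-∀
  ... | no j≢c = begin
    s * (C zero j * det (minor C zero j))
      ≡⟨ cong₂ (λ x d → s * (x * d)) (C≈A zero j j≢c) minor-linear ⟩
    s * (A zero j * (det (minor A zero j) + z * det (minor B zero j)))
      ≡⟨ ring s (A zero j) z _ _ ⟩
    tA j + z * (s * (A zero j * det (minor B zero j)))
      ≡⟨ cong (λ x → tA j + z * (s * (x * det (minor B zero j)))) (B≈A zero j j≢c) ⟨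
    tA j + z * tB j ∎
    where
    s = sign (toℕ j)
    ring : ∀ s a z d e → s * (a * (d + z * e)) ≡ s * (a * d) + z * (s * (a * e))
    ring = solve-∀
    minor-linear : det (minor C zero j) ≡ det (minor A zero j) + z * det (minor B zero j)
    minor-linear = det-linear-column (punchOut j≢c) z _ _ _
      (agreeOffColumn-minor j j≢c C≈A) (agreeOffColumn-minor j j≢c B≈A)
      (λ r → subst (λ k → C (suc r) k ≡ A (suc r) k + z * B (suc r) k) (sym (punchIn-punchOut j≢c)) (Cc (suc r)))

det-zero-column : ∀ {m} (c : Fin m) (A : Matrix m) → (∀ r → A r c ≡ + 0) → det A ≡ + 0
det-zero-column c A Ac≡0 = trans
  (det-linear-column c (- + 1) A A A (λ _ _ _ → refl) (λ _ _ _ → refl) λ r →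
    subst (λ x → x ≡ x + - + 1 * x) (sym (Ac≡0 r)) refl)
  (x-x≡0 (det A))
  where
  x-x≡0 : ∀ x → x + - + 1 * x ≡ + 0
  x-x≡0 = solve-∀

Consecutive : ∀ {m} → Fin m → Fin m → Set
Consecutive c c′ = toℕ c′ ≡ suc (toℕ c)

consecutive⇒≢ : ∀ {m} {c c′ : Fin m} → Consecutive c c′ → c ≢ c′
consecutive⇒≢ c′≡1+c refl = ℕ.1+n≢n (sym c′≡1+c)

punchOut-consecutive : ∀ {m} (j c c′ : Fin (suc m)) (j≢c : j ≢ c) (j≢c′ : j ≢ c′) →
  Consecutive c c′ → Consecutive (punchOut j≢c) (punchOut j≢c′)
punchOut-consecutive zero zero c′ j≢c j≢c′ _ = ⊥-elim (j≢c refl)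
punchOut-consecutive zero (suc c) (suc c′) j≢c j≢c′ c′≡1+c = ℕ.suc-injective c′≡1+c
punchOut-consecutive {suc m} (suc zero) zero (suc zero) j≢c j≢c′ _ = ⊥-elim (j≢c′ refl)
punchOut-consecutive {suc (suc m)} (suc (suc j)) zero (suc zero) j≢c j≢c′ _ = refl
punchOut-consecutive {suc m} (suc j) (suc c) (suc c′) j≢c j≢c′ c′≡1+c =
  cong suc (punchOut-consecutive j c c′ (j≢c ∘ cong suc) (j≢c′ ∘ cong suc) (ℕ.suc-injective c′≡1+c))

punchIn-consecutive : ∀ {m} {X : Set} (f : Fin (suc m) → X) (c c′ : Fin (suc m)) →
  Consecutive c c′ → f c ≡ f c′ → f ∘ punchIn c ≗ f ∘ punchIn c′
punchIn-consecutive f zero (suc zero) _ fc≡fc′ zero = sym fc≡fc′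
punchIn-consecutive f zero (suc zero) _ fc≡fc′ (suc k) = refl
punchIn-consecutive {suc m} f (suc c) (suc c′) _ fc≡fc′ zero = refl
punchIn-consecutive {suc m} f (suc c) (suc c′) c′≡1+c fc≡fc′ (suc k) =
  punchIn-consecutive (f ∘ suc) c c′ (ℕ.suc-injective c′≡1+c) fc≡fc′ k

det-consecutive-equal-columns : ∀ {m} (c c′ : Fin m) → Consecutive c c′ → (A : Matrix m) →
  (∀ r → A r c ≡ A r c′) → det A ≡ + 0
det-consecutive-equal-columns {suc m} c c′ c⋖c′ A Ac≡Ac′ = begin
  det A                                ≡⟨ sumFin-remove c F ⟩
  F c + sumFin (F ∘ punchIn c)         ≡⟨ cong (_+_ (F c)) (sumFin-single k′ (F ∘ punchIn c) others-vanish) ⟩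
  F c + F (punchIn c k′)               ≡⟨ cong (λ k → F c + F k) (punchIn-punchOut c≢c′) ⟩
  F c + F c′
    ≡⟨ cong (λ s → F c + s * (A zero c′ * det (minor A zero c′))) (trans (cong sign c⋖c′) (sign-suc (toℕ c))) ⟩
  F c + - sign (toℕ c) * (A zero c′ * det (minor A zero c′))
    ≡⟨ cong₂ (λ x d → F c + - sign (toℕ c) * (x * d)) (sym (Ac≡Ac′ zero)) (sym same-minor) ⟩
  F c + - sign (toℕ c) * (A zero c * det (minor A zero c))
    ≡⟨ cancel (sign (toℕ c)) (A zero c * det (minor A zero c)) ⟩
  + 0                                  ∎
  where
  open ≡-Reasoning
  F : Fin (suc m) → ℤ
  F j = sign (toℕ j) * (A zero j * det (minor A zero j))
  c≢c′ = consecutive⇒≢ c⋖c′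
  k′ = punchOut c≢c′
  cancel : ∀ s x → s * x + - s * x ≡ + 0
  cancel = solve-∀
  same-minor : det (minor A zero c) ≡ det (minor A zero c′)
  same-minor = det-cong λ r → punchIn-consecutive (A (suc r)) c c′ c⋖c′ (Ac≡Ac′ (suc r))
  vanish : ∀ j → j ≢ c → j ≢ c′ → F j ≡ + 0
  vanish j j≢c j≢c′ = trans
    (cong (λ d → sign (toℕ j) * (A zero j * d))
      (det-consecutive-equal-columns (punchOut j≢c) (punchOut j≢c′)
        (punchOut-consecutive j c c′ j≢c j≢c′ c⋖c′) (minor A zero j) λ r →
          trans (cong (A (suc r)) (punchIn-punchOut j≢c))
            (trans (Ac≡Ac′ (suc r)) (cong (A (suc r)) (sym (punchIn-punchOut j≢c′))))))
    (x*[y*0]≡0 (sign (toℕ j)) (A zero j))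
    where
    x*[y*0]≡0 : ∀ x y → x * (y * + 0) ≡ + 0
    x*[y*0]≡0 = solve-∀
  others-vanish : ∀ k → k ≢ k′ → F (punchIn c k) ≡ + 0
  others-vanish k k≢k′ = vanish (punchIn c k) (punchInᵢ≢i c k)
    λ ck≡c′ → k≢k′ (punchIn-injective c k k′ (trans ck≡c′ (sym (punchIn-punchOut c≢c′))))

setColumn : ∀ {m} → Fin m → (Fin m → ℤ) → Matrix m → Matrix m
setColumn c v A r k = if ⌊ k Fin.≟ c ⌋ then v r else A r k

setColumn-≡ : ∀ {m} (c : Fin m) v A r → setColumn c v A r c ≡ v r
setColumn-≡ c v A r = cong (λ b → if b then v r else A r c) (⌊⌋-true (c Fin.≟ c) refl)

setColumn-≢ : ∀ {m} {c : Fin m} v A r k → k ≢ c → setColumn c v A r k ≡ A r k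
setColumn-≢ {c = c} v A r k k≢c = cong (λ b → if b then v r else A r k) (⌊⌋-false (k Fin.≟ c) k≢c)

addToColumn : ∀ {m} → Fin m → Fin m → ℤ → Matrix m → Matrix m
addToColumn c c′ z A = setColumn c (λ r → A r c + z * A r c′) A

addToRow : ∀ {m} → Fin m → Fin m → ℤ → Matrix m → Matrix m
addToRow r r′ z A = transpose (addToColumn r r′ z (transpose A))

Adjacent : ∀ {m} → Fin m → Fin m → Set
Adjacent c c′ = Consecutive c c′ ⊎ Consecutive c′ c

det-addToColumn : ∀ {m} {c c′ : Fin m} → Adjacent c c′ → ∀ z A → det (addToColumn c c′ z A) ≡ det A
det-addToColumn {c = c} {c′} c~c′ z A = begin
  det (addToColumn c c′ z A)   ≡⟨ det-linear-column c z A B _ (setColumn-≢ added A) (setColumn-≢ column-c′ A) Cc ⟩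
  det A + z * det B            ≡⟨ cong (λ d → det A + z * d) B-singular ⟩
  det A + z * + 0              ≡⟨ x+y*0≡x (det A) z ⟩
  det A                        ∎
  where
  open ≡-Reasoning
  column-c′ added : Fin _ → ℤ
  column-c′ r = A r c′
  added r = A r c + z * A r c′
  B : Matrix _
  B = setColumn c column-c′ A
  c′≢c : c′ ≢ c
  c′≢c = [ (λ c⋖c′ → consecutive⇒≢ c⋖c′ ∘ sym) , consecutive⇒≢ ]′ c~c′
  Bc≡Bc′ : ∀ r → B r c ≡ B r c′
  Bc≡Bc′ r = trans (setColumn-≡ c column-c′ A r) (sym (setColumn-≢ column-c′ A r c′ c′≢c))
  B-singular : det B ≡ + 0
  B-singular = [ (λ c⋖c′ → det-consecutive-equal-columns c c′ c⋖c′ B Bc≡Bc′)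
               , (λ c′⋖c → det-consecutive-equal-columns c′ c c′⋖c B (sym ∘ Bc≡Bc′)) ]′ c~c′
  Cc : ∀ r → addToColumn c c′ z A r c ≡ A r c + z * B r c
  Cc r = trans (setColumn-≡ c added A r) (cong (λ x → A r c + z * x) (sym (setColumn-≡ c column-c′ A r)))
  x+y*0≡x : ∀ x y → x + y * + 0 ≡ x
  x+y*0≡x = solve-∀

det-addToRow : ∀ {m} {r r′ : Fin m} → Adjacent r r′ → ∀ z A → det (addToRow r r′ z A) ≡ det A
det-addToRow {r = r} {r′} r~r′ z A = begin
  det (addToRow r r′ z A)                      ≡⟨ det-transpose (addToColumn r r′ z (transpose A)) ⟩
  det (addToColumn r r′ z (transpose A))       ≡⟨ det-addToColumn r~r′ z (transpose A) ⟩
  det (transpose A)                            ≡⟨ det-transpose A ⟩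
  det A                                        ∎
  where open ≡-Reasoning

punchIn-punchIn-punchOut : ∀ {m} (c : Fin (suc (suc m))) (k : Fin (suc m)) (ck≢c : punchIn c k ≢ c) →
  punchIn (punchIn c k) ∘ punchIn (punchOut ck≢c) ≗ punchIn c ∘ punchIn k
punchIn-punchIn-punchOut zero    k       ck≢c x       = refl
punchIn-punchIn-punchOut (suc c) zero    ck≢c x       = refl
punchIn-punchIn-punchOut (suc c) (suc k) ck≢c zero    = refl
punchIn-punchIn-punchOut (suc c) (suc k) ck≢c (suc x) =
  cong suc (punchIn-punchIn-punchOut c k (ck≢c ∘ cong suc) x)

toℕ-punchIn-punchOut : ∀ {m} (c : Fin (suc m)) (k : Fin m) (ck≢c : punchIn c k ≢ c) →
  (toℕ (punchIn c k) ≡ toℕ k × toℕ c ≡ suc (toℕ (punchOut ck≢c))) ⊎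
  (toℕ (punchIn c k) ≡ suc (toℕ k) × toℕ (punchOut ck≢c) ≡ toℕ c)
toℕ-punchIn-punchOut {suc m} zero    k       ck≢c = inj₂ (refl , refl)
toℕ-punchIn-punchOut {suc m} (suc c) zero    ck≢c = inj₁ (refl , refl)
toℕ-punchIn-punchOut {suc m} (suc c) (suc k) ck≢c
  with toℕ-punchIn-punchOut c k (ck≢c ∘ cong suc)
... | inj₁ (e₁ , e₂) = inj₁ (cong suc e₁ , cong suc e₂)
... | inj₂ (e₁ , e₂) = inj₂ (cong suc e₁ , cong suc e₂)

sign-punchIn-punchOut : ∀ {m} r (c : Fin (suc m)) (k : Fin m) (ck≢c : punchIn c k ≢ c) →
  sign (toℕ (punchIn c k)) * sign (r ℕ.+ toℕ (punchOut ck≢c)) ≡ sign (suc (r ℕ.+ toℕ c)) * sign (toℕ k)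
sign-punchIn-punchOut r c k ck≢c with toℕ-punchIn-punchOut c k ck≢c
... | inj₁ (e₁ , e₂) rewrite e₁ | e₂ | ℕ.+-suc r (toℕ (punchOut ck≢c))
                           | sign-suc-suc (r ℕ.+ toℕ (punchOut ck≢c)) = ℤ.*-comm (sign (toℕ k)) _
... | inj₂ (e₁ , e₂) rewrite e₁ | e₂ | sign-suc (toℕ k) | sign-suc (r ℕ.+ toℕ c) =
  ring (sign (toℕ k)) (sign (r ℕ.+ toℕ c))
  where
  ring : ∀ x y → - x * y ≡ - y * x
  ring = solve-∀

det-single-entry-column : ∀ {m} (r c : Fin (suc m)) (A : Matrix (suc m)) →
  (∀ i → i ≢ r → A i c ≡ + 0) → det A ≡ sign (toℕ r ℕ.+ toℕ c) * (A r c * det (minor A r c))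
det-single-entry-column zero c A Ac≡0 = sumFin-single c F λ j j≢c →
  trans (cong (λ d → sign (toℕ j) * (A zero j * d))
          (det-zero-column (punchOut j≢c) (minor A zero j) λ i →
            trans (cong (A (suc i)) (punchIn-punchOut j≢c)) (Ac≡0 (suc i) λ ())))
        (x*[y*0]≡0 (sign (toℕ j)) (A zero j))
  where
  F : Fin _ → ℤ
  F j = sign (toℕ j) * (A zero j * det (minor A zero j))
  x*[y*0]≡0 : ∀ x y → x * (y * + 0) ≡ + 0
  x*[y*0]≡0 = solve-∀
det-single-entry-column {suc m} (suc r) c A Ac≡0 = begin
  det A                                       ≡⟨ sumFin-remove c F ⟩
  F c + sumFin (F ∘ punchIn c)                ≡⟨ cong₂ _+_ Fc≡0 (sumFin-cong term) ⟩
  + 0 + sumFin (λ k → s * (v * G k))          ≡⟨ ℤ.+-identityˡ _ ⟩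
  sumFin (λ k → s * (v * G k))                ≡⟨ *-distribˡ-sumFin s (λ k → v * G k) ⟨
  s * sumFin (λ k → v * G k)                  ≡⟨ cong (_*_ s) (*-distribˡ-sumFin v G) ⟨
  s * (v * det (minor A (suc r) c))           ∎
  where
  open ≡-Reasoning
  s = sign (suc (toℕ r ℕ.+ toℕ c))
  v = A (suc r) c
  F : Fin (suc (suc m)) → ℤ
  F j = sign (toℕ j) * (A zero j * det (minor A zero j))
  G : Fin (suc m) → ℤ
  G k = sign (toℕ k) * (A zero (punchIn c k) * det (minor (minor A (suc r) c) zero k))
  Fc≡0 : F c ≡ + 0
  Fc≡0 = trans (cong (λ x → sign (toℕ c) * (x * det (minor A zero c))) (Ac≡0 zero λ ()))
               (x*[0*y]≡0 (sign (toℕ c)) (det (minor A zero c)))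
    where
    x*[0*y]≡0 : ∀ x y → x * (+ 0 * y) ≡ + 0
    x*[0*y]≡0 = solve-∀
  term : ∀ k → F (punchIn c k) ≡ s * (v * G k)
  term k = begin
    F j
      ≡⟨ cong (λ d → sign (toℕ j) * (A zero j * d)) minor-expansion ⟩
    sign (toℕ j) * (A zero j * (sign (toℕ r ℕ.+ toℕ c′) * (v * d)))
      ≡⟨ regroup (sign (toℕ j)) (A zero j) (sign (toℕ r ℕ.+ toℕ c′)) v d ⟩
    (sign (toℕ j) * sign (toℕ r ℕ.+ toℕ c′)) * (A zero j * (v * d))
      ≡⟨ cong (λ x → x * (A zero j * (v * d))) (sign-punchIn-punchOut (toℕ r) c k j≢c) ⟩
    (s * sign (toℕ k)) * (A zero j * (v * d))
      ≡⟨ regroup′ s (sign (toℕ k)) (A zero j) v d ⟩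
    s * (v * G k) ∎
    where
    j = punchIn c k
    j≢c = punchInᵢ≢i c k
    c′ = punchOut j≢c
    d = det (minor (minor A (suc r) c) zero k)
    regroup : ∀ a b c d e → a * (b * (c * (d * e))) ≡ (a * c) * (b * (d * e))
    regroup = solve-∀
    regroup′ : ∀ a b c d e → (a * b) * (c * (d * e)) ≡ a * (d * (b * (c * e)))
    regroup′ = solve-∀
    minor-expansion : det (minor A zero j) ≡ sign (toℕ r ℕ.+ toℕ c′) * (v * d)
    minor-expansion = begin
      det (minor A zero j)
        ≡⟨ det-single-entry-column r c′ (minor A zero j) (λ i i≢r →
             trans (cong (A (suc i)) (punchIn-punchOut j≢c)) (Ac≡0 (suc i) (i≢r ∘ suc-injective))) ⟩
      sign (toℕ r ℕ.+ toℕ c′) * (A (suc r) (punchIn j c′) * det (minor (minor A zero j) r c′))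
        ≡⟨ cong₂ (λ x y → sign (toℕ r ℕ.+ toℕ c′) * (x * y)) (cong (A (suc r)) (punchIn-punchOut j≢c))
             (det-cong λ i x → cong (A (suc (punchIn r i))) (punchIn-punchIn-punchOut c k j≢c x)) ⟩
      sign (toℕ r ℕ.+ toℕ c′) * (v * d) ∎

det-single-entry-diagonal : ∀ {m} (r : Fin (suc m)) (A : Matrix (suc m)) →
  (∀ i → i ≢ r → A i r ≡ + 0) → det A ≡ A r r * det (minor A r r)
det-single-entry-diagonal r A Ar≡0 = begin
  det A                                                ≡⟨ det-single-entry-column r r A Ar≡0 ⟩
  sign (toℕ r ℕ.+ toℕ r) * (A r r * det (minor A r r))
    ≡⟨ cong (_* (A r r * det (minor A r r))) (sign-double (toℕ r)) ⟩
  + 1 * (A r r * det (minor A r r))                    ≡⟨ ℤ.*-identityˡ _ ⟩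
  A r r * det (minor A r r)                            ∎
  where open ≡-Reasoning

det-2×2 : (A : Matrix 2) → det A ≡ A zero zero * A (suc zero) (suc zero) - A zero (suc zero) * A (suc zero) zero
det-2×2 A = expand (A zero zero) (A zero (suc zero)) (A (suc zero) zero) (A (suc zero) (suc zero))
  where
  expand : ∀ a b c d → + 1 * (a * (+ 1 * (d * + 1) + + 0)) + (- + 1 * (b * (+ 1 * (c * + 1) + + 0)) + + 0)
                       ≡ a * d - b * c
  expand = solve-∀

-- Matrices constant on label classes

^ℤ≡^ : ∀ x k → x ^ℤ k ≡ x ℤ.^ k
^ℤ≡^ x zero    = refl
^ℤ≡^ x (suc k) = cong (_*_ x) (^ℤ≡^ x k)

^ℤ-distribˡ-+-* : ∀ x j k → x ^ℤ (j ℕ.+ k) ≡ (x ^ℤ j) * (x ^ℤ k)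
^ℤ-distribˡ-+-* x j k = begin
  x ^ℤ (j ℕ.+ k)            ≡⟨ ^ℤ≡^ x (j ℕ.+ k) ⟩
  x ℤ.^ (j ℕ.+ k)           ≡⟨ ℤ.^-distribˡ-+-* x j k ⟩
  x ℤ.^ j * x ℤ.^ k         ≡⟨ cong₂ _*_ (^ℤ≡^ x j) (^ℤ≡^ x k) ⟨
  (x ^ℤ j) * (x ^ℤ k)       ∎
  where open ≡-Reasoning

punchInℕ : ℕ → ℕ → ℕ
punchInℕ zero    t       = suc t
punchInℕ (suc p) zero    = zero
punchInℕ (suc p) (suc t) = suc (punchInℕ p t)

toℕ-punchIn : ∀ {m} (c : Fin (suc m)) (k : Fin m) → toℕ (punchIn c k) ≡ punchInℕ (toℕ c) (toℕ k)
toℕ-punchIn zero    k       = refl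
toℕ-punchIn (suc c) zero    = refl
toℕ-punchIn (suc c) (suc k) = cong suc (toℕ-punchIn c k)

punchInℕ-injective : ∀ p {s t} → punchInℕ p s ≡ punchInℕ p t → s ≡ t
punchInℕ-injective zero    {s}     {t}     e = ℕ.suc-injective e
punchInℕ-injective (suc p) {zero}  {zero}  e = refl
punchInℕ-injective (suc p) {suc s} {suc t} e = cong suc (punchInℕ-injective p (ℕ.suc-injective e))

punchInℕ-≢ : ∀ p t → punchInℕ p t ≢ p
punchInℕ-≢ (suc p) (suc t) e = punchInℕ-≢ p t (ℕ.suc-injective e)

punchInℕ-suc-self : ∀ p → punchInℕ (suc p) p ≡ p
punchInℕ-suc-self zero    = refl
punchInℕ-suc-self (suc p) = cong suc (punchInℕ-suc-self p)

Profile : Set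
Profile = List (ℕ × ℤ)

vertexAt : Profile → ℕ → ℕ × ℤ
vertexAt []       t       = (0 , + 0)  -- junk value past the end
vertexAt (v ∷ vs) zero    = v
vertexAt (v ∷ vs) (suc t) = vertexAt vs t

vertexAt-length : ∀ pre v post → vertexAt (pre ++ v ∷ post) (length pre) ≡ v
vertexAt-length []        v post = refl
vertexAt-length (_ ∷ pre) v post = vertexAt-length pre v post

vertexAt-suc-length : ∀ pre u v post → vertexAt (pre ++ u ∷ v ∷ post) (suc (length pre)) ≡ v
vertexAt-suc-length []        u v post = refl
vertexAt-suc-length (_ ∷ pre) u v post = vertexAt-suc-length pre u v post

vertexAt-punchIn : ∀ pre u v w post t → t ≢ length pre →
  vertexAt (pre ++ u ∷ v ∷ post) (punchInℕ (suc (length pre)) t) ≡ vertexAt (pre ++ w ∷ post) t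
vertexAt-punchIn []        u v w post zero    t≢p = ⊥-elim (t≢p refl)
vertexAt-punchIn []        u v w post (suc t) t≢p = refl
vertexAt-punchIn (_ ∷ pre) u v w post zero    t≢p = refl
vertexAt-punchIn (_ ∷ pre) u v w post (suc t) t≢p = vertexAt-punchIn pre u v w post t (t≢p ∘ cong suc)

vertexAt-replicate-++ : ∀ k v ys a → a < k → vertexAt (replicate k v ++ ys) a ≡ v
vertexAt-replicate-++ (suc k) v ys zero    _         = refl
vertexAt-replicate-++ (suc k) v ys (suc a) (s≤s a<k) = vertexAt-replicate-++ k v ys a a<k

vertexAt-replicate-++-≥ : ∀ k v ys a → k ≤ a → vertexAt (replicate k v ++ ys) a ≡ vertexAt ys (a ℕ.∸ k)
vertexAt-replicate-++-≥ zero    v ys a       _         = refl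
vertexAt-replicate-++-≥ (suc k) v ys (suc a) (s≤s k≤a) = vertexAt-replicate-++-≥ k v ys a k≤a

blocks : ℕ → ℕ → ℕ → Profile
blocks n t zero    = []
blocks n t (suc r) = replicate n (t , + 1) ++ blocks n (suc t) r

collapsedBlocks : ℕ → ℕ → ℕ → Profile
collapsedBlocks n t zero    = []
collapsedBlocks n t (suc r) = (t , + n) ∷ collapsedBlocks n (suc t) r

vertexAt-blocks : ∀ n′ t r a → a < r ℕ.* suc n′ → vertexAt (blocks (suc n′) t r) a ≡ (t ℕ.+ a / suc n′ , + 1)
vertexAt-blocks n′ t (suc r) a a<N with a ℕ.<? suc n′
... | yes a<n = trans (vertexAt-replicate-++ (suc n′) (t , + 1) _ a a<n)
  (cong (_, + 1) (sym (trans (cong (t ℕ.+_) (m<n⇒m/n≡0 a<n)) (ℕ.+-identityʳ t))))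
... | no a≮n = begin
  vertexAt (blocks (suc n′) t (suc r)) a              ≡⟨ vertexAt-replicate-++-≥ (suc n′) (t , + 1) _ a n≤a ⟩
  vertexAt (blocks (suc n′) (suc t) r) (a ℕ.∸ suc n′) ≡⟨ vertexAt-blocks n′ (suc t) r (a ℕ.∸ suc n′) a∸n<N ⟩
  (suc t ℕ.+ (a ℕ.∸ suc n′) / suc n′ , + 1)          ≡⟨ cong (_, + 1) (ℕ.+-suc t _) ⟨
  (t ℕ.+ suc ((a ℕ.∸ suc n′) / suc n′) , + 1)        ≡⟨ cong (λ q → (t ℕ.+ q , + 1)) (m/n≡1+[m∸n]/n n≤a) ⟨
  (t ℕ.+ a / suc n′ , + 1)                           ∎
  where
  open ≡-Reasoning
  n≤a = ℕ.≮⇒≥ a≮n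
  a∸n<N : a ℕ.∸ suc n′ < r ℕ.* suc n′
  a∸n<N = subst (a ℕ.∸ suc n′ <_) (ℕ.m+n∸m≡n (suc n′) (r ℕ.* suc n′)) (ℕ.∸-monoˡ-< a<N n≤a)

vertexAt-collapsedBlocks : ∀ n t r i → i < r → vertexAt (collapsedBlocks n t r) i ≡ (t ℕ.+ i , + n)
vertexAt-collapsedBlocks n t (suc r) zero    _         = cong (_, + n) (sym (ℕ.+-identityʳ t))
vertexAt-collapsedBlocks n t (suc r) (suc i) (s≤s i<r) =
  trans (vertexAt-collapsedBlocks n (suc t) r i i<r) (cong (_, + n) (sym (ℕ.+-suc t i)))

length-blocks : ∀ n t r → length (blocks n t r) ≡ r ℕ.* n
length-blocks n t zero    = refl
length-blocks n t (suc r) = begin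
  length (replicate n (t , + 1) ++ blocks n (suc t) r)        ≡⟨ length-++ (replicate n (t , + 1)) ⟩
  length (replicate n (t , + 1)) ℕ.+ length (blocks n (suc t) r)
    ≡⟨ cong₂ ℕ._+_ (length-replicate n) (length-blocks n (suc t) r) ⟩
  n ℕ.+ r ℕ.* n                                               ∎
  where open ≡-Reasoning

length-collapsedBlocks : ∀ n t r → length (collapsedBlocks n t r) ≡ r
length-collapsedBlocks n t zero    = refl
length-collapsedBlocks n t (suc r) = cong suc (length-collapsedBlocks n (suc t) r)

δ : ℕ → ℕ → ℤ → ℤ
δ x y a = if ⌊ x ℕ.≟ y ⌋ then a else + 0

δ-refl : ∀ x a → δ x x a ≡ a
δ-refl x a = cong (λ b → if b then a else + 0) (⌊⌋-true (x ℕ.≟ x) refl)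

δ-≢ : ∀ {x y} a → x ≢ y → δ x y a ≡ + 0
δ-≢ {x} {y} a x≢y = cong (λ b → if b then a else + 0) (⌊⌋-false (x ℕ.≟ y) x≢y)

δ-punchInℕ : ∀ p x y a → δ (punchInℕ p x) (punchInℕ p y) a ≡ δ x y a
δ-punchInℕ p x y a with x ℕ.≟ y
... | yes refl = δ-refl _ a
... | no x≢y   = δ-≢ a (x≢y ∘ punchInℕ-injective p)

module ClassMatrix (Λ : ℕ → ℤ) (Q : ℕ → ℕ → ℤ) where

  label : Profile → ℕ → ℕ
  label vs x = proj₁ (vertexAt vs x)

  weight : Profile → ℕ → ℤ
  weight vs x = proj₂ (vertexAt vs x)

  entry : Profile → ℕ → ℕ → ℤ
  entry vs x y = δ x y (Λ (label vs x)) + weight vs x * Q (label vs x) (label vs y)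

  classMatrix : ∀ {m} → Profile → Matrix m
  classMatrix vs i j = entry vs (toℕ i) (toℕ j)

  profileDet : Profile → ℤ
  profileDet vs = det {length vs} (classMatrix vs)

  entry-column-difference : ∀ vs x {y y′} → label vs y ≡ label vs y′ →
    entry vs x y′ + - + 1 * entry vs x y ≡ δ x y′ (Λ (label vs x)) + - + 1 * δ x y (Λ (label vs x))
  entry-column-difference vs x {y} {y′} ℓy≡ℓy′ rewrite ℓy≡ℓy′ =
    ring (δ x y′ (Λ (label vs x))) (δ x y (Λ (label vs x))) (weight vs x * Q (label vs x) (label vs y′))
    where
    ring : ∀ d′ d q → (d′ + q) + - + 1 * (d + q) ≡ d′ + - + 1 * d
    ring = solve-∀

  module Merge (pre : Profile) (a : ℕ) (w₁ w₂ : ℤ) (post : Profile) where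

    vs vs′ : Profile
    vs  = pre ++ (a , w₁) ∷ (a , w₂) ∷ post
    vs′ = pre ++ (a , w₁ + w₂) ∷ post

    p : ℕ
    p = length pre

    vs-p : vertexAt vs p ≡ (a , w₁)
    vs-p = vertexAt-length pre (a , w₁) ((a , w₂) ∷ post)

    vs-suc-p : vertexAt vs (suc p) ≡ (a , w₂)
    vs-suc-p = vertexAt-suc-length pre (a , w₁) (a , w₂) post

    vs′-p : vertexAt vs′ p ≡ (a , w₁ + w₂)
    vs′-p = vertexAt-length pre (a , w₁ + w₂) post

    label-punchIn : ∀ t → label vs (punchInℕ (suc p) t) ≡ label vs′ t
    label-punchIn t with t ℕ.≟ p
    ... | yes refl = begin
      label vs (punchInℕ (suc p) p) ≡⟨ cong (label vs) (punchInℕ-suc-self p) ⟩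
      label vs p                    ≡⟨ cong proj₁ vs-p ⟩
      a                             ≡⟨ cong proj₁ vs′-p ⟨
      label vs′ p                   ∎
      where open ≡-Reasoning
    ... | no t≢p = cong proj₁ (vertexAt-punchIn pre (a , w₁) (a , w₂) (a , w₁ + w₂) post t t≢p)

    entry-punchIn : ∀ x y → x ≢ p → entry vs (punchInℕ (suc p) x) (punchInℕ (suc p) y) ≡ entry vs′ x y
    entry-punchIn x y x≢p
      rewrite δ-punchInℕ (suc p) x y (Λ (label vs (punchInℕ (suc p) x)))
            | vertexAt-punchIn pre (a , w₁) (a , w₂) (a , w₁ + w₂) post x x≢p
            | label-punchIn y = refl

    entry-merged-row : ∀ y →
      entry vs p (punchInℕ (suc p) y) + + 1 * entry vs (suc p) (punchInℕ (suc p) y) ≡ entry vs′ p y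
    entry-merged-row y
      rewrite vs-p | vs-suc-p | vs′-p | label-punchIn y
            | δ-≢ (Λ a) (punchInℕ-≢ (suc p) y ∘ sym)
            | sym (cong (λ x → δ x (punchInℕ (suc p) y) (Λ a)) (punchInℕ-suc-self p))
            | δ-punchInℕ (suc p) p y (Λ a) =
      ring (δ p y (Λ a)) w₁ w₂ (Q a (label vs′ y))
      where
      ring : ∀ d w₁ w₂ q → d + w₁ * q + + 1 * (+ 0 + w₂ * q) ≡ d + (w₁ + w₂) * q
      ring = solve-∀

    -- Column p+1 minus column p is Λ a (e_{p+1} − e_p); adding row p+1 to row p then leaves
    -- Λ a alone in column p+1.
    module Elimination {m} (p<m : p < m) where

      A B C : Matrix (suc m)
      P P₁ : Fin (suc m)
      P  = fromℕ< (ℕ.m<n⇒m<1+n p<m)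
      P₁ = fromℕ< (s≤s p<m)
      A = classMatrix vs
      B = addToColumn P₁ P (- + 1) A
      C = addToRow P P₁ (+ 1) B

      toℕ-P : toℕ P ≡ p
      toℕ-P = toℕ-fromℕ< (ℕ.m<n⇒m<1+n p<m)

      toℕ-P₁ : toℕ P₁ ≡ suc p
      toℕ-P₁ = toℕ-fromℕ< (s≤s p<m)

      P⋖P₁ : Consecutive P P₁
      P⋖P₁ = trans toℕ-P₁ (cong suc (sym toℕ-P))

      B-column : ∀ i → let λᵢ = Λ (label vs (toℕ i)) in
        B i P₁ ≡ δ (toℕ i) (suc p) λᵢ + - + 1 * δ (toℕ i) p λᵢ
      B-column i rewrite setColumn-≡ P₁ (λ r → A r P₁ + - + 1 * A r P) A i | toℕ-P | toℕ-P₁ =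
        entry-column-difference vs (toℕ i) (trans (cong proj₁ vs-p) (sym (cong proj₁ vs-suc-p)))

      B-off : ∀ i k → k ≢ P₁ → B i k ≡ A i k
      B-off = setColumn-≢ (λ r → A r P₁ + - + 1 * A r P) A

      C-row-P : ∀ k → C P k ≡ B P k + + 1 * B P₁ k
      C-row-P = setColumn-≡ P (λ k → B P k + + 1 * B P₁ k) (transpose B)

      C-off : ∀ i k → i ≢ P → C i k ≡ B i k
      C-off i k = setColumn-≢ (λ k → B P k + + 1 * B P₁ k) (transpose B) k i

      B-P-P₁ : B P P₁ ≡ - Λ a
      B-P-P₁ rewrite B-column P | toℕ-P | vs-p
                   | δ-refl p (Λ a) | δ-≢ {p} {suc p} (Λ a) (ℕ.1+n≢n ∘ sym) =
        ring (Λ a)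
        where
        ring : ∀ x → + 0 + - + 1 * x ≡ - x
        ring = solve-∀

      B-P₁-P₁ : B P₁ P₁ ≡ Λ a
      B-P₁-P₁ rewrite B-column P₁ | toℕ-fromℕ< p<m | vs-suc-p
                    | δ-refl (suc p) (Λ a) | δ-≢ {suc p} {p} (Λ a) ℕ.1+n≢n =
        ring (Λ a)
        where
        ring : ∀ x → x + - + 1 * + 0 ≡ x
        ring = solve-∀

      B-other-P₁ : ∀ i → toℕ i ≢ p → toℕ i ≢ suc p → B i P₁ ≡ + 0
      B-other-P₁ i i≢p i≢1+p
        rewrite B-column i | δ-≢ (Λ (label vs (toℕ i))) i≢p | δ-≢ (Λ (label vs (toℕ i))) i≢1+p = refl

      C-column : ∀ i → i ≢ P₁ → C i P₁ ≡ + 0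
      C-column i i≢P₁ = by-cases (i Fin.≟ P)
        where
        ring : ∀ x → - x + + 1 * x ≡ + 0
        ring = solve-∀
        by-cases : Dec (i ≡ P) → C i P₁ ≡ + 0
        by-cases (yes refl) = trans (C-row-P P₁) (trans (cong₂ (λ x y → x + + 1 * y) B-P-P₁ B-P₁-P₁) (ring (Λ a)))
        by-cases (no i≢P) = trans (C-off i P₁ i≢P)
          (B-other-P₁ i (λ i≡p → i≢P (toℕ-injective (trans i≡p (sym toℕ-P))))
                        (λ i≡1+p → i≢P₁ (toℕ-injective (trans i≡1+p (sym toℕ-P₁)))))

      C-pivot : C P₁ P₁ ≡ Λ a
      C-pivot = trans (C-off P₁ P₁ (consecutive⇒≢ P⋖P₁ ∘ sym)) B-P₁-P₁

      toℕ-punchIn-P₁ : ∀ i → toℕ (punchIn P₁ i) ≡ punchInℕ (suc p) (toℕ i)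
      toℕ-punchIn-P₁ i = trans (toℕ-punchIn P₁ i) (cong (λ q → punchInℕ q (toℕ i)) toℕ-P₁)

      punchIn-P₁≡P : ∀ i → toℕ i ≡ p → punchIn P₁ i ≡ P
      punchIn-P₁≡P i i≡p = toℕ-injective (begin
        toℕ (punchIn P₁ i)             ≡⟨ toℕ-punchIn-P₁ i ⟩
        punchInℕ (suc p) (toℕ i)       ≡⟨ cong (punchInℕ (suc p)) i≡p ⟩
        punchInℕ (suc p) p             ≡⟨ punchInℕ-suc-self p ⟩
        p                              ≡⟨ toℕ-P ⟨
        toℕ P                          ∎)
        where open ≡-Reasoning

      punchIn-P₁≢P : ∀ i → toℕ i ≢ p → punchIn P₁ i ≢ P
      punchIn-P₁≢P i i≢p i₁≡P = i≢p (punchInℕ-injective (suc p) (begin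
        punchInℕ (suc p) (toℕ i)       ≡⟨ toℕ-punchIn-P₁ i ⟨
        toℕ (punchIn P₁ i)             ≡⟨ cong toℕ i₁≡P ⟩
        toℕ P                          ≡⟨ toℕ-P ⟩
        p                              ≡⟨ punchInℕ-suc-self p ⟨
        punchInℕ (suc p) p             ∎))
        where open ≡-Reasoning

      C-minor : ∀ i j → minor C P₁ P₁ i j ≡ classMatrix vs′ i j
      C-minor i j = by-cases (toℕ i ℕ.≟ p)
        where
        open ≡-Reasoning
        K : Fin (suc m)
        K = punchIn P₁ j
        B≡A : ∀ r → B r K ≡ A r K
        B≡A r = B-off r K (punchInᵢ≢i P₁ j)
        by-cases : Dec (toℕ i ≡ p) → C (punchIn P₁ i) K ≡ entry vs′ (toℕ i) (toℕ j)
        by-cases (yes i≡p) = begin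
          C (punchIn P₁ i) K                 ≡⟨ cong (λ r → C r K) (punchIn-P₁≡P i i≡p) ⟩
          C P K                              ≡⟨ C-row-P K ⟩
          B P K + + 1 * B P₁ K               ≡⟨ cong₂ (λ x y → x + + 1 * y) (B≡A P) (B≡A P₁) ⟩
          A P K + + 1 * A P₁ K
            ≡⟨ cong₂ (λ x y → entry vs x (toℕ K) + + 1 * entry vs y (toℕ K)) toℕ-P toℕ-P₁ ⟩
          entry vs p (toℕ K) + + 1 * entry vs (suc p) (toℕ K)
            ≡⟨ cong (λ y → entry vs p y + + 1 * entry vs (suc p) y) (toℕ-punchIn-P₁ j) ⟩
          entry vs p (punchInℕ (suc p) (toℕ j)) + + 1 * entry vs (suc p) (punchInℕ (suc p) (toℕ j))
            ≡⟨ entry-merged-row (toℕ j) ⟩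
          entry vs′ p (toℕ j)                ≡⟨ cong (λ x → entry vs′ x (toℕ j)) i≡p ⟨
          entry vs′ (toℕ i) (toℕ j)          ∎
        by-cases (no i≢p) = begin
          C (punchIn P₁ i) K                 ≡⟨ C-off (punchIn P₁ i) K (punchIn-P₁≢P i i≢p) ⟩
          B (punchIn P₁ i) K                 ≡⟨ B≡A (punchIn P₁ i) ⟩
          entry vs (toℕ (punchIn P₁ i)) (toℕ K)
            ≡⟨ cong₂ (entry vs) (toℕ-punchIn-P₁ i) (toℕ-punchIn-P₁ j) ⟩
          entry vs (punchInℕ (suc p) (toℕ i)) (punchInℕ (suc p) (toℕ j))
            ≡⟨ entry-punchIn (toℕ i) (toℕ j) i≢p ⟩
          entry vs′ (toℕ i) (toℕ j)          ∎

    det-merge : ∀ {m} → p < m → det {suc m} (classMatrix vs) ≡ Λ a * det {m} (classMatrix vs′)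
    det-merge {m} p<m = begin
      det A                              ≡⟨ det-addToColumn (inj₂ P⋖P₁) (- + 1) A ⟨
      det B                              ≡⟨ det-addToRow (inj₁ P⋖P₁) (+ 1) B ⟨
      det C                              ≡⟨ det-single-entry-diagonal P₁ C C-column ⟩
      C P₁ P₁ * det (minor C P₁ P₁)      ≡⟨ cong₂ _*_ C-pivot (det-cong C-minor) ⟩
      Λ a * det {m} (classMatrix vs′)    ∎
      where
      open ≡-Reasoning
      open Elimination p<m

    profileDet-merge : profileDet vs ≡ Λ a * profileDet vs′
    profileDet-merge = trans (cong (λ m → det {m} (classMatrix vs)) length-vs) (det-merge p<length-vs′)
      where
      length-vs′ : length vs′ ≡ suc (length (pre ++ post))
      length-vs′ = length-++-sucʳ pre (a , w₁ + w₂) post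
      length-vs : length vs ≡ suc (length vs′)
      length-vs = begin
        length vs                                   ≡⟨ length-++-sucʳ pre (a , w₁) ((a , w₂) ∷ post) ⟩
        suc (length (pre ++ (a , w₂) ∷ post))       ≡⟨ cong suc (length-++-sucʳ pre (a , w₂) post) ⟩
        suc (suc (length (pre ++ post)))            ≡⟨ cong suc length-vs′ ⟨
        suc (length vs′)                            ∎
        where open ≡-Reasoning
      p<length-vs′ : p < length vs′
      p<length-vs′ = subst (p <_) (sym length-vs′) (s≤s (length-++-≤ˡ pre))

  profileDet-merge-run : ∀ pre a w₀ w k post →
    profileDet (pre ++ (a , w₀) ∷ replicate k (a , w) ++ post)
      ≡ (Λ a ^ℤ k) * profileDet (pre ++ (a , w₀ + + k * w) ∷ post)
  profileDet-merge-run pre a w₀ w zero post = begin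
    profileDet (pre ++ (a , w₀) ∷ post)
      ≡⟨ cong (λ u → profileDet (pre ++ (a , u) ∷ post)) (ring w₀ w) ⟩
    profileDet (pre ++ (a , w₀ + + 0 * w) ∷ post)
      ≡⟨ ℤ.*-identityˡ _ ⟨
    + 1 * profileDet (pre ++ (a , w₀ + + 0 * w) ∷ post) ∎
    where
    open ≡-Reasoning
    ring : ∀ w₀ w → w₀ ≡ w₀ + + 0 * w
    ring = solve-∀
  profileDet-merge-run pre a w₀ w (suc k) post = begin
    profileDet (pre ++ (a , w₀) ∷ (a , w) ∷ replicate k (a , w) ++ post)
      ≡⟨ Merge.profileDet-merge pre a w₀ w (replicate k (a , w) ++ post) ⟩
    Λ a * profileDet (pre ++ (a , w₀ + w) ∷ replicate k (a , w) ++ post)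
      ≡⟨ cong (_*_ (Λ a)) (profileDet-merge-run pre a (w₀ + w) w k post) ⟩
    Λ a * ((Λ a ^ℤ k) * profileDet (pre ++ (a , w₀ + w + + k * w) ∷ post))
      ≡⟨ cong (λ u → Λ a * ((Λ a ^ℤ k) * profileDet (pre ++ (a , u) ∷ post))) (ring w₀ w (+ k)) ⟩
    Λ a * ((Λ a ^ℤ k) * profileDet (pre ++ (a , w₀ + (+ 1 + + k) * w) ∷ post))
      ≡⟨ ℤ.*-assoc (Λ a) (Λ a ^ℤ k) _ ⟨
    (Λ a ^ℤ suc k) * profileDet (pre ++ (a , w₀ + + suc k * w) ∷ post) ∎
    where
    open ≡-Reasoning
    ring : ∀ w₀ w k → w₀ + w + k * w ≡ w₀ + (+ 1 + k) * w
    ring = solve-∀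

  profileDet-collapse-blocks : ∀ {x} → (∀ s → Λ (suc s) ≡ x) → ∀ n r t pre →
    profileDet (pre ++ blocks (suc n) (suc t) r)
      ≡ (x ^ℤ (r ℕ.* n)) * profileDet (pre ++ collapsedBlocks (suc n) (suc t) r)
  profileDet-collapse-blocks {x} Λ≡x n zero t pre = sym (ℤ.*-identityˡ _)
  profileDet-collapse-blocks {x} Λ≡x n (suc r) t pre = begin
    profileDet (pre ++ (suc t , + 1) ∷ replicate n (suc t , + 1) ++ rest)
      ≡⟨ profileDet-merge-run pre (suc t) (+ 1) (+ 1) n rest ⟩
    (Λ (suc t) ^ℤ n) * profileDet (pre ++ (suc t , + 1 + + n * + 1) ∷ rest)
      ≡⟨ cong₂ (λ y u → (y ^ℤ n) * profileDet u) (Λ≡x t) reassociate ⟩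
    (x ^ℤ n) * profileDet (pre′ ++ rest)
      ≡⟨ cong (_*_ (x ^ℤ n)) (profileDet-collapse-blocks Λ≡x n r (suc t) pre′) ⟩
    (x ^ℤ n) * ((x ^ℤ (r ℕ.* n)) * profileDet (pre′ ++ collapsedBlocks (suc n) (suc (suc t)) r))
      ≡⟨ cong (λ u → (x ^ℤ n) * ((x ^ℤ (r ℕ.* n)) * profileDet u)) (++-assoc pre _ _) ⟩
    (x ^ℤ n) * ((x ^ℤ (r ℕ.* n)) * profileDet (pre ++ collapsedBlocks (suc n) (suc t) (suc r)))
      ≡⟨ ℤ.*-assoc (x ^ℤ n) _ _ ⟨
    ((x ^ℤ n) * (x ^ℤ (r ℕ.* n))) * profileDet (pre ++ collapsedBlocks (suc n) (suc t) (suc r))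
      ≡⟨ cong (_* profileDet (pre ++ collapsedBlocks (suc n) (suc t) (suc r))) (^ℤ-distribˡ-+-* x n (r ℕ.* n)) ⟨
    (x ^ℤ (suc r ℕ.* n)) * profileDet (pre ++ collapsedBlocks (suc n) (suc t) (suc r)) ∎
    where
    open ≡-Reasoning
    rest = blocks (suc n) (suc (suc t)) r
    pre′ = pre ++ (suc t , + suc n) ∷ []
    reassociate : pre ++ (suc t , + 1 + + n * + 1) ∷ rest ≡ pre′ ++ rest
    reassociate = trans (cong (λ w → pre ++ (suc t , w) ∷ rest) (cong (_+_ (+ 1)) (ℤ.*-identityʳ (+ n))))
                        (sym (++-assoc pre _ rest))

-- Distances and eccentricities

anyFin-true : ∀ {N} (f : Fin N → Bool) w → f w ≡ true → anyFin f ≡ true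
anyFin-true f zero    fw≡true = cong (_∨ anyFin (f ∘ suc)) fw≡true
anyFin-true f (suc w) fw≡true = trans (cong (f zero ∨_) (anyFin-true (f ∘ suc) w fw≡true)) (∨-zeroʳ (f zero))

anyFin-false : ∀ {N} (f : Fin N → Bool) → (∀ w → f w ≡ false) → anyFin f ≡ false
anyFin-false {zero}  f f≡false = refl
anyFin-false {suc N} f f≡false = cong₂ _∨_ (f≡false zero) (anyFin-false (f ∘ suc) (f≡false ∘ suc))

maxFin-lub : ∀ {N} (f : Fin N → ℕ) {b} → (∀ v → f v ≤ b) → maxFin f ≤ b
maxFin-lub {zero}  f f≤b = z≤n
maxFin-lub {suc N} f f≤b = ℕ.⊔-lub (f≤b zero) (maxFin-lub (f ∘ suc) (f≤b ∘ suc))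

maxFin-upper : ∀ {N} (f : Fin N → ℕ) v → f v ≤ maxFin f
maxFin-upper f zero    = ℕ.m≤m⊔n (f zero) _
maxFin-upper f (suc v) = ℕ.≤-trans (maxFin-upper (f ∘ suc) v) (ℕ.m≤n⊔m (f zero) _)

search-least : ∀ (p : ℕ → Bool) s k fuel → k < fuel → p (k ℕ.+ s) ≡ true →
  (∀ j → j < k → p (j ℕ.+ s) ≡ false) → search p s fuel ≡ k ℕ.+ s
search-least p s zero (suc fuel) _ ps≡true _ = cong (λ b → if b then s else search p (suc s) fuel) ps≡true
search-least p s (suc k) (suc fuel) (s≤s k<fuel) pk≡true below = begin
  search p s (suc fuel)    ≡⟨ cong (λ b → if b then s else search p (suc s) fuel) (below 0 (s≤s z≤n)) ⟩
  search p (suc s) fuel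
    ≡⟨ search-least p (suc s) k fuel k<fuel (subst (λ i → p i ≡ true) (sym (ℕ.+-suc k s)) pk≡true)
         (λ j j<k → subst (λ i → p i ≡ false) (sym (ℕ.+-suc j s)) (below (suc j) (s≤s j<k))) ⟩
  k ℕ.+ suc s              ≡⟨ ℕ.+-suc k s ⟩
  suc k ℕ.+ s              ∎
  where open ≡-Reasoning

module _ {N} (adj : Fin N → Fin N → Bool) where

  dist-≡ : ∀ u v k → k < N → reach adj k u v ≡ true → (∀ j → j < k → reach adj j u v ≡ false) →
    dist adj u v ≡ k
  dist-≡ u v k k<N reach-k below = trans
    (search-least (λ j → reach adj j u v) 0 k N k<N
      (subst (λ i → reach adj i u v ≡ true) (sym (ℕ.+-identityʳ k)) reach-k)
      (λ j j<k → subst (λ i → reach adj i u v ≡ false) (sym (ℕ.+-identityʳ j)) (below j j<k)))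
    (ℕ.+-identityʳ k)

  reach-refl : ∀ u → reach adj 0 u u ≡ true
  reach-refl u = ⌊⌋-true (toℕ u ℕ.≟ toℕ u) refl

  reach-0-≢ : ∀ u v → toℕ u ≢ toℕ v → reach adj 0 u v ≡ false
  reach-0-≢ u v u≢v = ⌊⌋-false (toℕ u ℕ.≟ toℕ v) u≢v

  reach-suc : ∀ k u v → reach adj k u v ≡ true → reach adj (suc k) u v ≡ true
  reach-suc k u v reach-k = cong (_∨ anyFin (λ w → reach adj k u w ∧ adj w v)) reach-k

  reach-step : ∀ k u w v → reach adj k u w ≡ true → adj w v ≡ true → reach adj (suc k) u v ≡ true
  reach-step k u w v reach-k uw = trans
    (cong (reach adj k u v ∨_) (anyFin-true (λ w → reach adj k u w ∧ adj w v) w (cong₂ _∧_ reach-k uw)))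
    (∨-zeroʳ (reach adj k u v))

  reach-1-false : ∀ u v → toℕ u ≢ toℕ v → adj u v ≡ false → reach adj 1 u v ≡ false
  reach-1-false u v u≢v ¬uv = cong₂ _∨_ (reach-0-≢ u v u≢v) (anyFin-false _ no-step)
    where
    no-step : ∀ w → (reach adj 0 u w ∧ adj w v) ≡ false
    no-step w with toℕ u ℕ.≟ toℕ w
    ... | yes u≡w = trans (cong (λ w → adj w v) (sym (toℕ-injective u≡w))) ¬uv
    ... | no _    = refl

  dist-refl : ∀ u → dist adj u u ≡ 0
  dist-refl u = dist-≡ u u 0 (ℕ.≤-trans (s≤s z≤n) (toℕ<n u)) (reach-refl u) λ _ ()

  dist-adjacent : 1 < N → ∀ u v → toℕ u ≢ toℕ v → adj u v ≡ true → dist adj u v ≡ 1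
  dist-adjacent 1<N u v u≢v uv = dist-≡ u v 1 1<N (reach-step 0 u u v (reach-refl u) uv)
    λ { zero _ → reach-0-≢ u v u≢v ; (suc _) (s≤s ()) }

  dist-nonadjacent : 2 < N → ∀ u v → toℕ u ≢ toℕ v → adj u v ≡ false → reach adj 2 u v ≡ true →
    dist adj u v ≡ 2
  dist-nonadjacent 2<N u v u≢v ¬uv reach-2 = dist-≡ u v 2 2<N reach-2
    λ { zero _ → reach-0-≢ u v u≢v ; (suc zero) _ → reach-1-false u v u≢v ¬uv ; (suc (suc _)) (s≤s (s≤s ())) }

  ecc-≡ : ∀ u d → (∀ v → dist adj u v ≤ d) → ∀ w → dist adj u w ≡ d → ecc adj u ≡ d
  ecc-≡ u d bound w uw≡d = ℕ.≤-antisym (maxFin-lub (dist adj u) bound)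
    (subst (_≤ ecc adj u) uw≡d (maxFin-upper (dist adj u) w))

  eccMatrix-≡ : ∀ u v {d e} → dist adj u v ≡ d → ecc adj u ⊓ ecc adj v ≡ e →
    eccMatrix adj u v ≡ (if ⌊ d ℕ.≟ e ⌋ then + d else + 0)
  eccMatrix-≡ u v d≡ e≡ = cong₂ (λ d e → if ⌊ d ℕ.≟ e ⌋ then + d else + 0) d≡ e≡

  eccMatrix-diagonal : ∀ u → eccMatrix adj u u ≡ + 0
  eccMatrix-diagonal u = trans (eccMatrix-≡ u u (dist-refl u) refl) (both-zero ⌊ 0 ℕ.≟ ecc adj u ⊓ ecc adj u ⌋)
    where
    both-zero : ∀ b → (if b then + 0 else + 0) ≡ + 0
    both-zero true  = refl
    both-zero false = refl

-- The graph K_{2n} ∘ₙ ⋯ ∘ₙ K_{2n}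

-- ε(G) between distinct vertices of blocks b, b′ (block 0 is C): 1 if one lies in C, 0 inside
-- one P_s, 2 between distinct P_s.  On the diagonal ε(G) vanishes, which Λ₁ accounts for.
εBlock : ℕ → ℕ → ℤ
εBlock zero    _       = + 1
εBlock (suc _) zero    = + 1
εBlock (suc s) (suc t) = if ⌊ s ℕ.≟ t ⌋ then + 0 else + 2

Λ₁ : ℤ → ℕ → ℤ
Λ₁ x zero    = x + + 1
Λ₁ x (suc _) = x

Q₁ : ℕ → ℕ → ℤ
Q₁ b b′ = - εBlock b b′

Λ₁-Q₁-diagonal : ∀ x b → x - + 0 ≡ Λ₁ x b + + 1 * Q₁ b b
Λ₁-Q₁-diagonal x zero    = ring x
  where
  ring : ∀ x → x - + 0 ≡ x + + 1 + + 1 * - + 1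
  ring = solve-∀
Λ₁-Q₁-diagonal x (suc b) rewrite ⌊⌋-true (b ℕ.≟ b) refl = ring x
  where
  ring : ∀ x → x - + 0 ≡ x + + 1 * - + 0
  ring = solve-∀

module Vertices (x : ℤ) = ClassMatrix (Λ₁ x) Q₁

module GluedK (n′ l : ℕ) (2≤l : 2 ≤ l) where

  n N : ℕ
  n = suc n′
  N = n ℕ.+ l ℕ.* n

  G : Fin N → Fin N → Bool
  G = gluedK n l

  blockOf : Fin N → ℕ
  blockOf u = block n (toℕ u)

  G-adjacent : ∀ u v → toℕ u ≢ toℕ v →
    blockOf u ≡ 0 ⊎ blockOf v ≡ 0 ⊎ blockOf u ≡ blockOf v → G u v ≡ true
  G-adjacent u v u≢v blocks-ok =
    cong₂ (λ b c → not b ∧ c) (⌊⌋-false (toℕ u ℕ.≟ toℕ v) u≢v) (some-true blocks-ok)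
    where
    bu = blockOf u
    bv = blockOf v
    some-true : bu ≡ 0 ⊎ bv ≡ 0 ⊎ bu ≡ bv →
      (⌊ bu ℕ.≟ 0 ⌋ ∨ ⌊ bv ℕ.≟ 0 ⌋ ∨ ⌊ bu ℕ.≟ bv ⌋) ≡ true
    some-true (inj₁ bu≡0) = cong (_∨ (⌊ bv ℕ.≟ 0 ⌋ ∨ ⌊ bu ℕ.≟ bv ⌋)) (⌊⌋-true (bu ℕ.≟ 0) bu≡0)
    some-true (inj₂ (inj₁ bv≡0)) =
      trans (cong (λ b → ⌊ bu ℕ.≟ 0 ⌋ ∨ b ∨ ⌊ bu ℕ.≟ bv ⌋) (⌊⌋-true (bv ℕ.≟ 0) bv≡0)) (∨-zeroʳ _)
    some-true (inj₂ (inj₂ bu≡bv)) =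
      trans (cong (λ b → ⌊ bu ℕ.≟ 0 ⌋ ∨ ⌊ bv ℕ.≟ 0 ⌋ ∨ b) (⌊⌋-true (bu ℕ.≟ bv) bu≡bv))
            (trans (cong (⌊ bu ℕ.≟ 0 ⌋ ∨_) (∨-zeroʳ _)) (∨-zeroʳ _))

  G-nonadjacent : ∀ u v → blockOf u ≢ 0 → blockOf v ≢ 0 → blockOf u ≢ blockOf v → G u v ≡ false
  G-nonadjacent u v bu≢0 bv≢0 bu≢bv = trans
    (cong (not ⌊ toℕ u ℕ.≟ toℕ v ⌋ ∧_)
      (cong₂ _∨_ (⌊⌋-false (blockOf u ℕ.≟ 0) bu≢0)
        (cong₂ _∨_ (⌊⌋-false (blockOf v ℕ.≟ 0) bv≢0) (⌊⌋-false (blockOf u ℕ.≟ blockOf v) bu≢bv))))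
    (∧-zeroʳ _)

  reach-1-zero : ∀ u → reach G 1 u zero ≡ true
  reach-1-zero zero    = reach-suc G 0 zero zero (reach-refl G zero)
  reach-1-zero (suc u) = reach-step G 0 (suc u) (suc u) zero (reach-refl G (suc u))
    (G-adjacent (suc u) zero (λ ()) (inj₂ (inj₁ refl)))

  reach-2 : ∀ u v → reach G 2 u v ≡ true
  reach-2 u zero    = reach-suc G 1 u zero (reach-1-zero u)
  reach-2 u (suc v) = reach-step G 1 u zero (suc v) (reach-1-zero u) (G-adjacent zero (suc v) (λ ()) (inj₁ refl))

  2n<N : 2 ℕ.* n < N
  2n<N = ℕ.<-≤-trans (ℕ.m<n+m (2 ℕ.* n) {n} (s≤s z≤n)) (ℕ.+-monoʳ-≤ n (ℕ.*-monoˡ-≤ n 2≤l))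

  n<N : n < N
  n<N = ℕ.≤-<-trans (ℕ.m≤m+n n (n ℕ.+ 0)) 2n<N

  2<N : 2 < N
  2<N = ℕ.≤-<-trans (ℕ.*-monoʳ-≤ 2 (s≤s (z≤n {n′}))) 2n<N

  inP₁ inP₂ : Fin N
  inP₁ = fromℕ< n<N
  inP₂ = fromℕ< 2n<N

  blockOf-inP₁ : blockOf inP₁ ≡ 1
  blockOf-inP₁ = trans (cong (_/ n) (toℕ-fromℕ< n<N)) (n/n≡1 n)

  blockOf-inP₂ : blockOf inP₂ ≡ 2
  blockOf-inP₂ = trans (cong (_/ n) (toℕ-fromℕ< 2n<N)) (m*n/n≡m 2 n)

  blockOf-≢ : ∀ u v → blockOf u ≢ blockOf v → toℕ u ≢ toℕ v
  blockOf-≢ u v bu≢bv u≡v = bu≢bv (cong (_/ n) u≡v)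

  dist-self : ∀ u v → toℕ u ≡ toℕ v → dist G u v ≡ 0
  dist-self u v u≡v = trans (cong (dist G u) (sym (toℕ-injective u≡v))) (dist-refl G u)

  dist-G-adjacent : ∀ u v → toℕ u ≢ toℕ v → G u v ≡ true → dist G u v ≡ 1
  dist-G-adjacent = dist-adjacent G (ℕ.<-trans (s≤s (s≤s z≤n)) 2<N)

  dist≤2 : ∀ u v → dist G u v ≤ 2
  dist≤2 u v = by-cases (toℕ u ℕ.≟ toℕ v) (G u v) refl
    where
    by-cases : Dec (toℕ u ≡ toℕ v) → ∀ b → G u v ≡ b → dist G u v ≤ 2
    by-cases (yes u≡v) _     _  = ℕ.≤-trans (ℕ.≤-reflexive (dist-self u v u≡v)) z≤n
    by-cases (no u≢v)  true  uv = ℕ.≤-trans (ℕ.≤-reflexive (dist-G-adjacent u v u≢v uv)) (s≤s z≤n)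
    by-cases (no u≢v)  false uv = ℕ.≤-reflexive (dist-nonadjacent G 2<N u v u≢v uv (reach-2 u v))

  dist-C≤1 : ∀ u → blockOf u ≡ 0 → ∀ v → dist G u v ≤ 1
  dist-C≤1 u bu≡0 v = by-cases (toℕ u ℕ.≟ toℕ v)
    where
    by-cases : Dec (toℕ u ≡ toℕ v) → dist G u v ≤ 1
    by-cases (yes u≡v) = ℕ.≤-trans (ℕ.≤-reflexive (dist-self u v u≡v)) z≤n
    by-cases (no u≢v)  = ℕ.≤-reflexive (dist-G-adjacent u v u≢v (G-adjacent u v u≢v (inj₁ bu≡0)))

  ecc-C : ∀ u → blockOf u ≡ 0 → ecc G u ≡ 1
  ecc-C u bu≡0 = ecc-≡ G u 1 (dist-C≤1 u bu≡0) inP₁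
    (dist-G-adjacent u inP₁ u≢inP₁ (G-adjacent u inP₁ u≢inP₁ (inj₁ bu≡0)))
    where
    u≢inP₁ = blockOf-≢ u inP₁ λ bu≡b₁ → ℕ.0≢1+n (trans (sym bu≡0) (trans bu≡b₁ blockOf-inP₁))

  ecc-P : ∀ u → blockOf u ≢ 0 → ecc G u ≡ 2
  ecc-P u bu≢0 = at-distance-2 (vertex-in-another-P (blockOf u ℕ.≟ 1))
    where
    vertex-in-another-P : Dec (blockOf u ≡ 1) → Σ (Fin N) λ w → blockOf w ≢ 0 × blockOf u ≢ blockOf w
    vertex-in-another-P (yes bu≡1) = inP₂ , (λ b≡0 → ℕ.0≢1+n (trans (sym b≡0) blockOf-inP₂))
                                      , (λ bu≡b → ℕ.1+n≢n (sym (trans (sym bu≡1) (trans bu≡b blockOf-inP₂))))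
    vertex-in-another-P (no bu≢1)  = inP₁ , (λ b≡0 → ℕ.0≢1+n (trans (sym b≡0) blockOf-inP₁))
                                      , (λ bu≡b → bu≢1 (trans bu≡b blockOf-inP₁))
    at-distance-2 : Σ (Fin N) (λ w → blockOf w ≢ 0 × blockOf u ≢ blockOf w) → ecc G u ≡ 2
    at-distance-2 (w , bw≢0 , bu≢bw) = ecc-≡ G u 2 (dist≤2 u) w
      (dist-nonadjacent G 2<N u w (blockOf-≢ u w bu≢bw) (G-nonadjacent u w bu≢0 bw≢0 bu≢bw) (reach-2 u w))

  ecc-positive : ∀ v → Σ ℕ λ e → ecc G v ≡ suc e
  ecc-positive v with blockOf v ℕ.≟ 0
  ... | yes bv≡0 = 0 , ecc-C v bv≡0
  ... | no bv≢0  = 1 , ecc-P v bv≢0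

  eccMatrix-off-diagonal : ∀ u v → toℕ u ≢ toℕ v → eccMatrix G u v ≡ εBlock (blockOf u) (blockOf v)
  eccMatrix-off-diagonal u v u≢v = by-blocks (blockOf u) (blockOf v) refl refl
    where
    dist-1 : _ → dist G u v ≡ 1
    dist-1 blocks-ok = dist-G-adjacent u v u≢v (G-adjacent u v u≢v blocks-ok)
    by-blocks : ∀ bu bv → blockOf u ≡ bu → blockOf v ≡ bv → eccMatrix G u v ≡ εBlock bu bv
    by-blocks zero bv bu≡0 _ =
      eccMatrix-≡ G u v (dist-1 (inj₁ bu≡0)) (cong₂ _⊓_ (ecc-C u bu≡0) (proj₂ (ecc-positive v)))
    by-blocks (suc a) zero bu≡1+a bv≡0 =
      eccMatrix-≡ G u v (dist-1 (inj₂ (inj₁ bv≡0)))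
        (cong₂ _⊓_ (ecc-P u (ℕ.1+n≢0 ∘ trans (sym bu≡1+a))) (ecc-C v bv≡0))
    by-blocks (suc a) (suc b) bu≡1+a bv≡1+b = by-P-index (a ℕ.≟ b)
      where
      bu≢0 = ℕ.1+n≢0 ∘ trans (sym bu≡1+a)
      bv≢0 = ℕ.1+n≢0 ∘ trans (sym bv≡1+b)
      both-in-P : ecc G u ⊓ ecc G v ≡ 2
      both-in-P = cong₂ _⊓_ (ecc-P u bu≢0) (ecc-P v bv≢0)
      by-P-index : Dec (a ≡ b) → eccMatrix G u v ≡ εBlock (suc a) (suc b)
      by-P-index (yes a≡b) = trans
        (eccMatrix-≡ G u v (dist-1 (inj₂ (inj₂ (trans bu≡1+a (trans (cong suc a≡b) (sym bv≡1+b)))))) both-in-P)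
        (cong (λ c → if c then + 0 else + 2) (sym (⌊⌋-true (a ℕ.≟ b) a≡b)))
      by-P-index (no a≢b) = trans
        (eccMatrix-≡ G u v
          (dist-nonadjacent G 2<N u v u≢v (G-nonadjacent u v bu≢0 bv≢0 bu≢bv) (reach-2 u v)) both-in-P)
        (cong (λ c → if c then + 0 else + 2) (sym (⌊⌋-false (a ℕ.≟ b) a≢b)))
        where
        bu≢bv : blockOf u ≢ blockOf v
        bu≢bv bu≡bv = a≢b (ℕ.suc-injective (trans (sym bu≡1+a) (trans bu≡bv bv≡1+b)))

  xI-ε blockEntry : ℤ → Fin N → Fin N → ℤ
  xI-ε x u v = δ (toℕ u) (toℕ v) x - eccMatrix G u v
  blockEntry x u v = δ (toℕ u) (toℕ v) (Λ₁ x (blockOf u)) + + 1 * Q₁ (blockOf u) (blockOf v)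

  xI-ε-diagonal : ∀ x u → xI-ε x u u ≡ blockEntry x u u
  xI-ε-diagonal x u = begin
    δ (toℕ u) (toℕ u) x - eccMatrix G u u           ≡⟨ cong₂ _-_ (δ-refl (toℕ u) x) (eccMatrix-diagonal G u) ⟩
    x - + 0                                         ≡⟨ Λ₁-Q₁-diagonal x (blockOf u) ⟩
    Λ₁ x (blockOf u) + + 1 * Q₁ (blockOf u) (blockOf u)
      ≡⟨ cong (_+ + 1 * Q₁ (blockOf u) (blockOf u)) (δ-refl (toℕ u) (Λ₁ x (blockOf u))) ⟨
    blockEntry x u u                                ∎
    where open ≡-Reasoning

  xI-ε-off-diagonal : ∀ x u v → toℕ u ≢ toℕ v → xI-ε x u v ≡ blockEntry x u v
  xI-ε-off-diagonal x u v u≢v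
    rewrite δ-≢ x u≢v | δ-≢ (Λ₁ x (blockOf u)) u≢v | eccMatrix-off-diagonal u v u≢v =
    ring (εBlock (blockOf u) (blockOf v))
    where
    ring : ∀ e → + 0 - e ≡ + 0 + + 1 * - e
    ring = solve-∀

  xI-ε≡classMatrix : ∀ x u v → xI-ε x u v ≡ Vertices.classMatrix x (blocks n 0 (suc l)) u v
  xI-ε≡classMatrix x u v
    rewrite vertexAt-blocks n′ 0 (suc l) (toℕ u) (toℕ<n u)
          | vertexAt-blocks n′ 0 (suc l) (toℕ v) (toℕ<n v) = by-cases (toℕ u ℕ.≟ toℕ v)
    where
    by-cases : Dec (toℕ u ≡ toℕ v) → xI-ε x u v ≡ blockEntry x u v
    by-cases (yes u≡v) = subst (λ w → xI-ε x u w ≡ blockEntry x u w) (toℕ-injective u≡v) (xI-ε-diagonal x u)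
    by-cases (no u≢v)  = xI-ε-off-diagonal x u v u≢v

-- The quotient matrix

-- After merging, P_s has weight n and entries δ x + n Q₁; giving every P_s the label 1 rewrites
-- its diagonal x as (x + 2n) + n · (−2).
Λ₂ : ℤ → ℕ → ℕ → ℤ
Λ₂ x n zero    = x + + 1
Λ₂ x n (suc _) = x + + 2 * + n

Q₂ : ℕ → ℕ → ℤ
Q₂ zero    _       = - + 1
Q₂ (suc _) zero    = - + 1
Q₂ (suc _) (suc _) = - + 2

module Quotient (x : ℤ) (n : ℕ) = ClassMatrix (Λ₂ x n) Q₂

relabel-entry : ∀ x n l (i j : Fin (suc l)) →
  Vertices.classMatrix x ((0 , + n) ∷ collapsedBlocks n 1 l) i j
    ≡ Quotient.classMatrix x n ((0 , + n) ∷ replicate l (1 , + n) ++ []) i j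
relabel-entry x n l zero    zero    = refl
relabel-entry x n l zero    (suc j) = refl
relabel-entry x n l (suc i) zero
  rewrite vertexAt-collapsedBlocks n 1 l (toℕ i) (toℕ<n i)
        | vertexAt-replicate-++ l (1 , + n) [] (toℕ i) (toℕ<n i) = refl
relabel-entry x n l (suc i) (suc j)
  rewrite vertexAt-collapsedBlocks n 1 l (toℕ i) (toℕ<n i)
        | vertexAt-replicate-++ l (1 , + n) [] (toℕ i) (toℕ<n i)
        | vertexAt-collapsedBlocks n 1 l (toℕ j) (toℕ<n j)
        | vertexAt-replicate-++ l (1 , + n) [] (toℕ j) (toℕ<n j) = by-cases (toℕ i ℕ.≟ toℕ j)
  where
  by-cases : Dec (toℕ i ≡ toℕ j) →
    δ (suc (toℕ i)) (suc (toℕ j)) x + + n * Q₁ (suc (toℕ i)) (suc (toℕ j))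
      ≡ δ (suc (toℕ i)) (suc (toℕ j)) (x + + 2 * + n) + + n * - + 2
  by-cases (yes i≡j) rewrite i≡j | ⌊⌋-true (toℕ j ℕ.≟ toℕ j) refl
                           | δ-refl (suc (toℕ j)) x | δ-refl (suc (toℕ j)) (x + + 2 * + n) = ring x (+ n)
    where
    ring : ∀ x n → x + n * - + 0 ≡ x + + 2 * n + n * - + 2
    ring = solve-∀
  by-cases (no i≢j) rewrite ⌊⌋-false (toℕ i ℕ.≟ toℕ j) i≢j
                          | δ-≢ x (i≢j ∘ ℕ.suc-injective) | δ-≢ (x + + 2 * + n) (i≢j ∘ ℕ.suc-injective) = refl

profileDet-relabel : ∀ x n l →
  Vertices.profileDet x ((0 , + n) ∷ collapsedBlocks n 1 l)
    ≡ Quotient.profileDet x n ((0 , + n) ∷ replicate l (1 , + n) ++ [])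
profileDet-relabel x n l = begin
  det {suc (length P₁)} (Vertices.classMatrix x ((0 , + n) ∷ P₁))
    ≡⟨ cong (λ m → det {suc m} M₁) (length-collapsedBlocks n 1 l) ⟩
  det {suc l} M₁                                                  ≡⟨ det-cong (relabel-entry x n l) ⟩
  det {suc l} M₂                                                  ≡⟨ cong (λ m → det {suc m} M₂) length-P₂ ⟨
  det {suc (length P₂)} (Quotient.classMatrix x n ((0 , + n) ∷ P₂)) ∎
  where
  open ≡-Reasoning
  P₁ = collapsedBlocks n 1 l
  P₂ = replicate l (1 , + n) ++ []
  M₁ = λ {m} → Vertices.classMatrix x {m} ((0 , + n) ∷ P₁)
  M₂ = λ {m} → Quotient.classMatrix x n {m} ((0 , + n) ∷ P₂)
  length-P₂ : length P₂ ≡ l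
  length-P₂ = trans (cong length (++-identityʳ (replicate l (1 , + n)))) (length-replicate l)

profileDet-merge-within-blocks : ∀ n′ l x →
  Vertices.profileDet x (blocks (suc n′) 0 (suc l))
    ≡ ((x + + 1) ^ℤ n′) *
      ((x ^ℤ (l ℕ.* n′)) * Vertices.profileDet x ((0 , + suc n′) ∷ collapsedBlocks (suc n′) 1 l))
profileDet-merge-within-blocks n′ l x = begin
  Vertices.profileDet x ((0 , + 1) ∷ replicate n′ (0 , + 1) ++ blocks n 1 l)
    ≡⟨ Vertices.profileDet-merge-run x [] 0 (+ 1) (+ 1) n′ (blocks n 1 l) ⟩
  ((x + + 1) ^ℤ n′) * Vertices.profileDet x ((0 , + 1 + + n′ * + 1) ∷ blocks n 1 l)
    ≡⟨ cong (λ w → ((x + + 1) ^ℤ n′) * Vertices.profileDet x ((0 , + 1 + w) ∷ blocks n 1 l))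
            (ℤ.*-identityʳ (+ n′)) ⟩
  ((x + + 1) ^ℤ n′) * Vertices.profileDet x (((0 , + n) ∷ []) ++ blocks n 1 l)
    ≡⟨ cong (_*_ ((x + + 1) ^ℤ n′)) (Vertices.profileDet-collapse-blocks x (λ _ → refl) n′ l 0 ((0 , + n) ∷ [])) ⟩
  ((x + + 1) ^ℤ n′) * ((x ^ℤ (l ℕ.* n′)) * Vertices.profileDet x ((0 , + n) ∷ collapsedBlocks n 1 l)) ∎
  where
  open ≡-Reasoning
  n = suc n′

profileDet-quotient : ∀ n l′ x → let l = suc l′ in
  Vertices.profileDet x ((0 , + n) ∷ collapsedBlocks n 1 l)
    ≡ ((x + + 2 * + n) ^ℤ l′) * ((x + + 1 - + n) * (x + + 2 * + n - + 2 * (+ l * + n)) - + n * (+ l * + n))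
profileDet-quotient n l′ x = begin
  Vertices.profileDet x ((0 , + n) ∷ collapsedBlocks n 1 (suc l′))
    ≡⟨ profileDet-relabel x n (suc l′) ⟩
  Quotient.profileDet x n (((0 , + n) ∷ []) ++ (1 , + n) ∷ replicate l′ (1 , + n) ++ [])
    ≡⟨ Quotient.profileDet-merge-run x n ((0 , + n) ∷ []) 1 (+ n) (+ n) l′ [] ⟩
  ((x + + 2 * + n) ^ℤ l′) * Quotient.profileDet x n ((0 , + n) ∷ (1 , + n + + l′ * + n) ∷ [])
    ≡⟨ cong (_*_ ((x + + 2 * + n) ^ℤ l′))
         (trans (det-2×2 (Quotient.classMatrix x n ((0 , + n) ∷ (1 , + n + + l′ * + n) ∷ []))) (expand x (+ n) (+ l′))) ⟩
  ((x + + 2 * + n) ^ℤ l′) * ((x + + 1 - + n) * (x + + 2 * + n - + 2 * ((+ 1 + + l′) * + n)) - + n * ((+ 1 + + l′) * + n)) ∎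
  where
  open ≡-Reasoning
  expand : ∀ x n l′ →
    (x + + 1 + n * - + 1) * (x + + 2 * n + (n + l′ * n) * - + 2) - (+ 0 + n * - + 1) * (+ 0 + (n + l′ * n) * - + 1)
      ≡ (x + + 1 - n) * (x + + 2 * n - + 2 * ((+ 1 + l′) * n)) - n * ((+ 1 + l′) * n)
  expand = solve-∀

profileDet-blocks : ∀ n′ l′ x →
  Vertices.profileDet x (blocks (suc n′) 0 (suc (suc l′))) ≡ targetPoly (suc n′) (suc l′) x
profileDet-blocks n′ l′ x = begin
  Vertices.profileDet x (blocks n 0 (suc l))
    ≡⟨ profileDet-merge-within-blocks n′ l x ⟩
  ((x + + 1) ^ℤ n′) * ((x ^ℤ (l ℕ.* n′)) * Vertices.profileDet x ((0 , + n) ∷ collapsedBlocks n 1 l))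
    ≡⟨ cong (λ d → ((x + + 1) ^ℤ n′) * ((x ^ℤ (l ℕ.* n′)) * d)) (profileDet-quotient n l′ x) ⟩
  ((x + + 1) ^ℤ n′) * ((x ^ℤ (l ℕ.* n′)) * (((x + + 2 * + n) ^ℤ l′) * quotientDet))
    ≡⟨ regroup ((x + + 1) ^ℤ n′) (x ^ℤ (l ℕ.* n′)) ((x + + 2 * + n) ^ℤ l′) x (+ n) (+ l′) ⟩
  (x ^ℤ (l ℕ.* n′)) * ((x + + 1) ^ℤ n′) * ((x + + 2 * + n) ^ℤ l′) * quadratic
    ≡⟨ cong₂ (λ e c → (x ^ℤ e) * ((x + + 1) ^ℤ n′) * (c ^ℤ l′) * quadratic)
         (ℕ.*-comm l n′) (cong (_+_ x) (sym (ℤ.pos-* 2 n))) ⟩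
  targetPoly n l x ∎
  where
  open ≡-Reasoning
  n l : ℕ
  n = suc n′
  l = suc l′
  quotientDet = (x + + 1 - + n) * (x + + 2 * + n - + 2 * (+ l * + n)) - + n * (+ l * + n)
  quadratic = x * x + x * (+ 1 - + n * (+ 2 * + l - + 1)) + (+ n * + n) * (+ l - + 2) - + 2 * + n * (+ l - + 1)
  regroup : ∀ A B C x n l′ →
    A * (B * (C * ((x + + 1 - n) * (x + + 2 * n - + 2 * ((+ 1 + l′) * n)) - n * ((+ 1 + l′) * n))))
      ≡ B * A * C * (x * x + x * (+ 1 - n * (+ 2 * (+ 1 + l′) - + 1))
                    + (n * n) * ((+ 1 + l′) - + 2) - + 2 * n * ((+ 1 + l′) - + 1))
  regroup = solve-∀

mainTheorem17 : (n l : ℕ) → 2 ≤ n → 2 ≤ l →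
    (x : ℤ) → charPoly (eccMatrix (gluedK n l)) x ≡ targetPoly n l x
mainTheorem17 (suc n′) (suc l′) _ 2≤l x = begin
  charPoly (eccMatrix (gluedK n l)) x                  ≡⟨ det-cong (GluedK.xI-ε≡classMatrix n′ l 2≤l x) ⟩
  det {n ℕ.+ l ℕ.* n} (Vertices.classMatrix x profile)
    ≡⟨ cong (λ m → det {m} (Vertices.classMatrix x profile)) (length-blocks n 0 (suc l)) ⟨
  Vertices.profileDet x profile                        ≡⟨ profileDet-blocks n′ l′ x ⟩
  targetPoly n l x                                     ∎
  where
  open ≡-Reasoning
  n l : ℕ
  n = suc n′
  l = suc l′
  profile = blocks n 0 (suc l)
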